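{- Let $t\ge2$, $\omega$ a primitive $t$-th root of unity, $m\ge1$, $Y=(y_1,\dots,y_m)$, and $\lambda\in\mathcal P_{tm}$. Then $s_{\lambda/\mu}(Y,\omega Y,\dots,\omega^{t-1}Y)=0$ for every partition $\mu\subsetneq\lambda$ if and only if $\lambda$ is a $t$-core.
   Context: Partitions $\lambda=(\lambda_1\ge\dots\ge0)$, $\mathcal P_k$ = partitions with at most $k$ nonzero parts; $\mu\subseteq\lambda$ means $\mu_i\le\lambda_i$ for all $i$. $h_k$ complete homogeneous symmetric polynomial ($h_0=1$, $h_k=0$ for $k<0$); skew Schur polynomial $s_{\lambda/\mu}(Z)=\det(h_{\lambda_i-\mu_j-i+j}(Z))_{1\le i,j\le N}$ for $N\ge\ell(\lambda)$. $cY=(cy_1,\dots,cy_m)$. $t$-core: for $\lambda\in\mathcal P_M$ let $\beta_j=\lambda_j+M-j$ and $n_i$ the number of $\beta_j\equiv i\pmod t$; list the integers $tj+i$ ($0\le i\le t-1$, $0\le j\le n_i-1$) decreasingly as $b_1>\dots>b_M$; the $t$-core of $\lambda$ has parts $b_j-M+j$; $\lambda$ is a $t$-core if it equals its $t$-core. -}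

module Defs where

open import Level using (Level)
open import Data.Nat as ℕ using (ℕ; zero; suc; _∸_; _≤_; NonZero)
open import Data.Nat.DivMod using (_%_)
open import Data.Integer as ℤ using (ℤ; +_; -[1+_])
open import Data.Fin as Fin using (Fin; toℕ; punchIn)
open import Data.List as List using (List; []; _∷_; _++_; map; concatMap; foldr; upTo; length; filter; allFin; zipWith)
open import Data.Vec as Vec using (Vec; lookup; toList)
open import Data.Bool using (if_then_else_)
open import Data.Product using (_×_; Σ)
open import Data.Sum using (_⊎_)
open import Relation.Nullary using (¬_)
open import Relation.Binary.PropositionalEquality using (_≡_)
import Data.Nat.Properties as ℕP
open import Algebra.Bundles using (CommutativeRing)

-- Partitions (stored with exactly M entries, trailing zeros allowed)

IsPartition : {M : ℕ} → Vec ℕ M → Set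
IsPartition {M} lam = (i j : Fin M) → toℕ i ≤ toℕ j → lookup lam j ≤ lookup lam i

_⊆ₚ_ : {M : ℕ} → Vec ℕ M → Vec ℕ M → Set
_⊆ₚ_ {M} mu lam = (i : Fin M) → lookup mu i ≤ lookup lam i

insertDec : ℕ → List ℕ → List ℕ
insertDec x [] = x ∷ []
insertDec x (y ∷ ys) = if y ℕ.≤ᵇ x then x ∷ y ∷ ys else y ∷ insertDec x ys

sortDec : List ℕ → List ℕ
sortDec = foldr insertDec []

module _ (t : ℕ) .{{_ : NonZero t}} where

  -- β_j = λ_j + M - j  (1-based j); with 0-based index i: λ_i + M - 1 - i
  betas : {M : ℕ} → Vec ℕ M → List ℕ
  betas {M} lam = List.map (λ i → lookup lam i ℕ.+ M ∸ suc (toℕ i)) (allFin M)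

  countRes : List ℕ → ℕ → ℕ
  countRes bs r = length (filter (λ b → (b % t) ℕ.≟ r) bs)

  coreBetas : {M : ℕ} → Vec ℕ M → List ℕ
  coreBetas lam =
    sortDec (concatMap (λ r → List.map (λ j → t ℕ.* j ℕ.+ r) (upTo (countRes (betas lam) r))) (upTo t))

  tCore : {M : ℕ} → Vec ℕ M → List ℕ
  tCore {M} lam = zipWith (λ b j → b ℕ.+ suc j ∸ M) (coreBetas lam) (upTo M)

  IsTCore : {M : ℕ} → Vec ℕ M → Set
  IsTCore lam = tCore lam ≡ toList lam

module Alg {c ℓ : Level} (R : CommutativeRing c ℓ) where
  open CommutativeRing R

  pow : Carrier → ℕ → Carrier
  pow x zero = 1#
  pow x (suc n) = x * pow x n

  sumL : List Carrier → Carrier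
  sumL = foldr _+_ 0#

  natR : ℕ → Carrier
  natR zero = 0#
  natR (suc n) = 1# + natR n

  CharZero : Set ℓ
  CharZero = (n : ℕ) → 1 ≤ n → ¬ (natR n ≈ 0#)

  IsIntegralDomain : Set (c Level.⊔ ℓ)
  IsIntegralDomain = (x y : Carrier) → x * y ≈ 0# → (x ≈ 0#) ⊎ (y ≈ 0#)

  IsPrimitiveRoot : ℕ → Carrier → Set ℓ
  IsPrimitiveRoot t ω = (pow ω t ≈ 1#) × ((k : ℕ) → 1 ≤ k → k ℕ.< t → ¬ (pow ω k ≈ 1#))

  hN : ℕ → List Carrier → Carrier
  hN zero [] = 1#
  hN (suc k) [] = 0#
  hN k (z ∷ zs) = sumL (List.map (λ j → pow z j * hN (k ∸ j) zs) (upTo (suc k)))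

  h : ℤ → List Carrier → Carrier
  h (+ k) zs = hN k zs
  h -[1+ k ] zs = 0#

  det : (n : ℕ) → (Fin n → Fin n → Carrier) → Carrier
  det zero A = 1#
  det (suc n) A =
    sumL (List.map (λ j → pow (- 1#) (toℕ j) * (A Fin.zero j * det n (λ a b → A (Fin.suc a) (punchIn j b))))
                   (allFin (suc n)))

  skewSchur : {N : ℕ} → Vec ℕ N → Vec ℕ N → List Carrier → Carrier
  skewSchur {N} lam mu zs =
    det N (λ i j → h (((+ lookup lam i) ℤ.- (+ lookup mu j)) ℤ.- (+ toℕ i) ℤ.+ (+ toℕ j)) zs)

  twisted : ℕ → Carrier → {m : ℕ} → Vec Carrier m → List Carrier
  twisted t ω ys = concatMap (λ k → List.map (λ y → pow ω k * y) (toList ys)) (upTo t)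

{-# OPTIONS --safe #-}
module Submission where

-- Write Z = (Y, ωY, …, ω^{t-1}Y) and β(ν)_i = ν_i + N - 1 - i for the β-numbers of ν.
-- Multiplying Z by ω permutes it, so a symmetric function homogeneous of degree k vanishes at Z
-- unless t ∣ k.  The (i, j) entry of the determinant defining s_{λ/μ}(Z) is h_{β(λ)_i - β(μ)_j}(Z),
-- so a permutation σ contributes only if each β(μ)_{σ i} is at most β(λ)_i and congruent to it
-- mod t.  λ is a t-core exactly when every β-number b ≥ t of λ has b - t among its β-numbers.
-- Then such a σ forces β(μ) = β(λ), so all these determinants vanish for μ ≠ λ.  Otherwise some
-- β(λ)_p - t is missing, and replacing β(λ)_p by it gives a partition μ ⊊ λ for which exactly
-- one σ contributes, with entries h_0 = 1 and h_t(Z).  For Y = (1, 0, …, 0) the nonzero entries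
-- of Z are the t-th roots of unity, where e_1, …, e_{t-1} vanish and e_t does not, so Newton's
-- identity Σ_j (-1)^j e_j h_{t-j} = 0 gives h_t(Z) ≠ 0.

open import Level using (Level; _⊔_)
open import Function using (_∘_; id)
open import Function.Definitions using (Injective)
open import Data.Nat as ℕ using (ℕ; zero; suc; _∸_; _≤_; _<_; z≤n; s≤s; NonZero; _≟_; _<?_; _≤?_)
import Data.Nat.Properties as ℕ
open import Data.Nat.DivMod using (_%_; _/_; m≡m%n+[m/n]*n; m%n<n; [m+kn]%n≡m%n; m<n⇒m%n≡m)
open import Data.Nat.Divisibility using (_∣_; _∣?_; divides; ∣-refl; ∣⇒≤; m%n≡0⇒n∣m)
open import Data.Integer as ℤ using (ℤ; _⊖_)
import Data.Integer.Properties as ℤ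
open import Data.Integer.Tactic.RingSolver using (solve-∀)
open import Data.Fin as Fin using (Fin; toℕ; punchIn; punchOut)
import Data.Fin.Properties as Fin
open import Data.List as List using (List; []; _∷_; _++_; map; concatMap; upTo; applyUpTo; tabulate; filter; length; zipWith)
import Data.List.Properties as List
open import Data.List.Membership.Propositional using (_∈_; _∉_; find; lose)
open import Data.List.Membership.DecPropositional _≟_ using (_∈?_)
import Data.List.Membership.Propositional.Properties as ∈
open import Data.List.Relation.Unary.Any using (here; there)
open import Data.List.Relation.Unary.All as All using (All; []; _∷_)
open import Data.List.Relation.Unary.AllPairs as AllPairs using (AllPairs; []; _∷_)
import Data.List.Relation.Unary.AllPairs.Properties as AllPairs
open import Data.List.Relation.Unary.Unique.Propositional using (Unique)
open import Data.List.Relation.Binary.Subset.Propositional using (_⊆_)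
import Data.List.Relation.Binary.Pointwise as Pointwise
open import Data.Vec as Vec using (Vec; lookup; toList)
import Data.Vec.Properties as Vec
open import Data.Maybe using (nothing)
open import Data.Bool using (true; false; T)
open import Data.Unit using (tt)
open import Data.Product using (_×_; _,_; proj₁; proj₂; ∃₂; ∃-syntax)
open import Data.Sum using (_⊎_; inj₁; inj₂; [_,_]′; map₂)
open import Data.Empty using (⊥-elim)
open import Relation.Nullary using (¬_; yes; no)
open import Relation.Nullary.Decidable using (_×-dec_; _→-dec_; decidable-stable)
open import Relation.Binary using (tri<; tri≈; tri>)
open import Relation.Binary.Definitions using (Decidable)
open import Relation.Binary.PropositionalEquality as ≡ using (_≡_; _≢_; _≗_)
open import Algebra.Bundles using (CommutativeRing)
open import Tactic.RingSolver.Core.AlmostCommutativeRing using (fromCommutativeRing)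
open import Defs

module BetaNumbers where

  open import Data.Nat using (_+_; _*_)
  open ≡ using (refl; sym; trans; cong; cong₂; subst; subst₂)

  Descending : List ℕ → Set
  Descending = AllPairs (λ a b → b < a)

  Descending⇒Unique : ∀ {xs} → Descending xs → Unique xs
  Descending⇒Unique = AllPairs.map (λ b<a a≡b → ℕ.<⇒≢ b<a (sym a≡b))

  Descending-head : ∀ {c cs} → Descending (c ∷ cs) → length cs ≤ c
  Descending-head {c} {[]}     _                      = z≤n
  Descending-head {c} {d ∷ cs} ((d<c ∷ _) ∷ d∷cs↓)    = ℕ.≤-trans (s≤s (Descending-head d∷cs↓)) d<c

  Descending-ext : ∀ {xs ys} → Descending xs → Descending ys → xs ⊆ ys → ys ⊆ xs → xs ≡ ys
  Descending-ext {[]}     {[]}     _ _ _ _ = refl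
  Descending-ext {[]}     {y ∷ ys} _ _ _ ys⊆xs with () ← ys⊆xs (here refl)
  Descending-ext {x ∷ xs} {[]}     _ _ xs⊆ys _ with () ← xs⊆ys (here refl)
  Descending-ext {x ∷ xs} {y ∷ ys} (x> ∷ xs↓) (y> ∷ ys↓) xs⊆ys ys⊆xs =
    cong₂ _∷_ x≡y (Descending-ext xs↓ ys↓ (tail-⊆ x> x≡y xs⊆ys) (tail-⊆ y> (sym x≡y) ys⊆xs))
    where
    head≤ : ∀ {a b bs} → All (_< b) bs → a ∈ b ∷ bs → a ≤ b
    head≤ _  (here a≡b) = ℕ.≤-reflexive a≡b
    head≤ b> (there a∈) = ℕ.<⇒≤ (All.lookup b> a∈)
    x≡y : x ≡ y
    x≡y = ℕ.≤-antisym (head≤ y> (xs⊆ys (here refl))) (head≤ x> (ys⊆xs (here refl)))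
    tail-⊆ : ∀ {a as b bs} → All (_< a) as → a ≡ b → a ∷ as ⊆ b ∷ bs → as ⊆ bs
    tail-⊆ a> a≡b as⊆ v∈ with as⊆ (there v∈)
    ... | here v≡b  = ⊥-elim (ℕ.<⇒≢ (All.lookup a> v∈) (trans v≡b (sym a≡b)))
    ... | there v∈' = v∈'

  length-mono-⊆ : ∀ {xs ys : List ℕ} → Unique xs → xs ⊆ ys → length xs ≤ length ys
  length-mono-⊆ {[]}     _             _     = z≤n
  length-mono-⊆ {x ∷ xs} (x∉xs ∷ xs!) x∷xs⊆ys with ∈.∈-∃++ (x∷xs⊆ys (here refl))
  ... | ys₁ , ys₂ , refl = subst (suc (length xs) ≤_) (sym (length-middle ys₁))
                                 (s≤s (length-mono-⊆ xs! (λ v∈xs → remove ys₁ (x∷xs⊆ys (there v∈xs)) (≢x v∈xs))))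
    where
    ≢x : ∀ {v} → v ∈ xs → v ≢ x
    ≢x v∈xs v≡x = All.lookup x∉xs v∈xs (sym v≡x)
    remove : ∀ ys₁ {ys₂ v} → v ∈ ys₁ ++ x ∷ ys₂ → v ≢ x → v ∈ ys₁ ++ ys₂
    remove []        (here v≡x) v≢x = ⊥-elim (v≢x v≡x)
    remove []        (there v∈) _   = v∈
    remove (y ∷ ys₁) (here v≡y) _   = here v≡y
    remove (y ∷ ys₁) (there v∈) v≢x = there (remove ys₁ v∈ v≢x)
    length-middle : ∀ ys₁ {ys₂} → length (ys₁ ++ x ∷ ys₂) ≡ suc (length (ys₁ ++ ys₂))
    length-middle []        = refl
    length-middle (y ∷ ys₁) = cong suc (length-middle ys₁)

  ∈-insertDec⁻ : ∀ x ys {v} → v ∈ insertDec x ys → v ≡ x ⊎ v ∈ ys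
  ∈-insertDec⁻ x []       (here v≡x) = inj₁ v≡x
  ∈-insertDec⁻ x (y ∷ ys) v∈ with y ℕ.≤ᵇ x
  ∈-insertDec⁻ x (y ∷ ys) (here v≡x) | true  = inj₁ v≡x
  ∈-insertDec⁻ x (y ∷ ys) (there v∈) | true  = inj₂ v∈
  ∈-insertDec⁻ x (y ∷ ys) (here v≡y) | false = inj₂ (here v≡y)
  ∈-insertDec⁻ x (y ∷ ys) (there v∈) | false = map₂ there (∈-insertDec⁻ x ys v∈)

  ∈-insertDec⁺ : ∀ x ys {v} → v ≡ x ⊎ v ∈ ys → v ∈ insertDec x ys
  ∈-insertDec⁺ x []       (inj₁ v≡x) = here v≡x
  ∈-insertDec⁺ x (y ∷ ys) v∈ with y ℕ.≤ᵇ x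
  ∈-insertDec⁺ x (y ∷ ys) (inj₁ v≡x)         | true  = here v≡x
  ∈-insertDec⁺ x (y ∷ ys) (inj₂ v∈)          | true  = there v∈
  ∈-insertDec⁺ x (y ∷ ys) (inj₁ v≡x)         | false = there (∈-insertDec⁺ x ys (inj₁ v≡x))
  ∈-insertDec⁺ x (y ∷ ys) (inj₂ (here v≡y))  | false = here v≡y
  ∈-insertDec⁺ x (y ∷ ys) (inj₂ (there v∈))  | false = there (∈-insertDec⁺ x ys (inj₂ v∈))

  ∈-sortDec⁻ : ∀ xs → sortDec xs ⊆ xs
  ∈-sortDec⁻ (x ∷ xs) v∈ = [ here , there ∘ ∈-sortDec⁻ xs ]′ (∈-insertDec⁻ x (sortDec xs) v∈)

  ∈-sortDec⁺ : ∀ xs → xs ⊆ sortDec xs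
  ∈-sortDec⁺ (x ∷ xs) (here v≡x) = ∈-insertDec⁺ x (sortDec xs) (inj₁ v≡x)
  ∈-sortDec⁺ (x ∷ xs) (there v∈) = ∈-insertDec⁺ x (sortDec xs) (inj₂ (∈-sortDec⁺ xs v∈))

  insertDec-descending : ∀ x {ys} → Descending ys → x ∉ ys → Descending (insertDec x ys)
  insertDec-descending x {[]}     _              _    = [] ∷ []
  insertDec-descending x {y ∷ ys} (y> ∷ ys↓) x∉y∷ys with y ℕ.≤ᵇ x in y≤ᵇx
  ... | true  = (y<x ∷ All.map (λ z<y → ℕ.<-trans z<y y<x) y>) ∷ y> ∷ ys↓
    where
    y<x : y < x
    y<x = ℕ.≤∧≢⇒< (ℕ.≤ᵇ⇒≤ y x (subst T (sym y≤ᵇx) tt)) (λ y≡x → x∉y∷ys (here (sym y≡x)))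
  ... | false = All-insertDec x<y y> ∷ insertDec-descending x ys↓ (x∉y∷ys ∘ there)
    where
    x<y : x < y
    x<y = ℕ.≰⇒> (λ y≤x → subst T y≤ᵇx (ℕ.≤⇒≤ᵇ y≤x))
    All-insertDec : ∀ {zs} → x < y → All (_< y) zs → All (_< y) (insertDec x zs)
    All-insertDec x<y zs<y = All.tabulate (λ v∈ → [ (λ v≡x → subst (_< y) (sym v≡x) x<y) , All.lookup zs<y ]′ (∈-insertDec⁻ x _ v∈))

  sortDec-descending : ∀ {xs} → Unique xs → Descending (sortDec xs)
  sortDec-descending {[]}     []            = []
  sortDec-descending {x ∷ xs} (x∉xs ∷ xs!)  =
    insertDec-descending x (sortDec-descending xs!) (λ x∈ → All.lookup x∉xs (∈-sortDec⁻ xs x∈) refl)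

  StrictlyDecreasing : ∀ {N} → (Fin N → ℕ) → Set
  StrictlyDecreasing f = ∀ {i j} → i Fin.< j → f j < f i

  StrictlyDecreasing⇒injective : ∀ {N} {f : Fin N → ℕ} → StrictlyDecreasing f → Injective _≡_ _≡_ f
  StrictlyDecreasing⇒injective {f = f} f↓ {i} {j} fᵢ≡fⱼ with ℕ.<-cmp (toℕ i) (toℕ j)
  ... | tri< i<j _ _ = ⊥-elim (ℕ.<⇒≢ (f↓ i<j) (sym fᵢ≡fⱼ))
  ... | tri≈ _ i≡j _ = Fin.toℕ-injective i≡j
  ... | tri> _ _ j<i = ⊥-elim (ℕ.<⇒≢ (f↓ j<i) fᵢ≡fⱼ)

  β : ∀ {N} → Vec ℕ N → Fin N → ℕ
  β {N} lam i = lookup lam i + N ∸ suc (toℕ i)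

  suc-toℕ≤+ : ∀ {N} x (i : Fin N) → suc (toℕ i) ≤ x + N
  suc-toℕ≤+ {N} x i = ℕ.≤-trans (Fin.toℕ<n i) (ℕ.m≤n+m N x)

  β-strictlyDecreasing : ∀ {N} (lam : Vec ℕ N) → IsPartition lam → StrictlyDecreasing (β lam)
  β-strictlyDecreasing {N} lam part {i} {j} i<j =
    ℕ.≤-<-trans (ℕ.∸-monoˡ-≤ (suc (toℕ j)) (ℕ.+-monoˡ-≤ N (part i j (ℕ.<⇒≤ i<j))))
                (ℕ.∸-monoʳ-< (s≤s i<j) (suc-toℕ≤+ (lookup lam i) j))

  β-mono : ∀ {N} (mu lam : Vec ℕ N) → mu ⊆ₚ lam → ∀ i → β mu i ≤ β lam i
  β-mono {N} mu lam mu⊆lam i = ℕ.∸-monoˡ-≤ (suc (toℕ i)) (ℕ.+-monoˡ-≤ N (mu⊆lam i))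

  β-cancel-≤ : ∀ {N} (mu lam : Vec ℕ N) i → β mu i ≤ β lam i → lookup mu i ≤ lookup lam i
  β-cancel-≤ {N} mu lam i βμ≤βλ = ℕ.+-cancelʳ-≤ (N ∸ suc (toℕ i)) _ _
    (subst₂ _≤_ (ℕ.+-∸-assoc (lookup mu i) (Fin.toℕ<n i)) (ℕ.+-∸-assoc (lookup lam i) (Fin.toℕ<n i)) βμ≤βλ)

  β-cancel : ∀ {N} (mu lam : Vec ℕ N) → (∀ i → β mu i ≡ β lam i) → mu ≡ lam
  β-cancel mu lam βμ≡βλ = Vec-ext (λ i → ℕ.≤-antisym (β-cancel-≤ mu lam i (ℕ.≤-reflexive (βμ≡βλ i)))
                                                       (β-cancel-≤ lam mu i (ℕ.≤-reflexive (sym (βμ≡βλ i)))))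
    where
    Vec-ext : (∀ i → lookup mu i ≡ lookup lam i) → mu ≡ lam
    Vec-ext eq = trans (sym (Vec.tabulate∘lookup mu)) (trans (Vec.tabulate-cong eq) (Vec.tabulate∘lookup lam))

  β⊖β : ∀ {N} (lam mu : Vec ℕ N) i j →
        ((ℤ.+ lookup lam i) ℤ.- (ℤ.+ lookup mu j)) ℤ.- (ℤ.+ toℕ i) ℤ.+ (ℤ.+ toℕ j) ≡ β lam i ⊖ β mu j
  β⊖β {N} lam mu i j = sym (begin
    β lam i ⊖ β mu j                                  ≡⟨ ℤ.m-n≡m⊖n (β lam i) (β mu j) ⟨
    ℤ.+ β lam i ℤ.- ℤ.+ β mu j                        ≡⟨ cong₂ ℤ._-_ (+∸ (suc-toℕ≤+ (lookup lam i) i)) (+∸ (suc-toℕ≤+ (lookup mu j) j)) ⟩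
    ((λᵢ ℤ.+ ℤ.+ N) ℤ.- (ℤ.+ 1 ℤ.+ ℤ.+ toℕ i)) ℤ.- ((μⱼ ℤ.+ ℤ.+ N) ℤ.- (ℤ.+ 1 ℤ.+ ℤ.+ toℕ j))
                                                      ≡⟨ normalise λᵢ μⱼ (ℤ.+ N) (ℤ.+ toℕ i) (ℤ.+ toℕ j) ⟩
    (λᵢ ℤ.- μⱼ) ℤ.- (ℤ.+ toℕ i) ℤ.+ (ℤ.+ toℕ j)      ∎)
    where
    open ≡.≡-Reasoning
    λᵢ μⱼ : ℤ
    λᵢ = ℤ.+ lookup lam i
    μⱼ = ℤ.+ lookup mu j
    +∸ : ∀ {a b} → b ≤ a → ℤ.+ (a ∸ b) ≡ ℤ.+ a ℤ.- ℤ.+ b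
    +∸ {a} {b} b≤a = trans (sym (ℤ.⊖-≥ b≤a)) (sym (ℤ.m-n≡m⊖n a b))
    normalise : ∀ (l m n i j : ℤ) → ((l ℤ.+ n) ℤ.- (ℤ.+ 1 ℤ.+ i)) ℤ.- ((m ℤ.+ n) ℤ.- (ℤ.+ 1 ℤ.+ j)) ≡ ((l ℤ.- m) ℤ.- i) ℤ.+ j
    normalise = solve-∀

  fromFin : ∀ {N} → (Fin N → ℕ) → ℕ → ℕ
  fromFin {N} f k with k <? N
  ... | yes k<N = f (Fin.fromℕ< k<N)
  ... | no  _   = 0

  fromFin-toℕ : ∀ {N} (f : Fin N → ℕ) i → fromFin f (toℕ i) ≡ f i
  fromFin-toℕ {N} f i with toℕ i <? N
  ... | yes i<N = cong f (Fin.fromℕ<-toℕ i i<N)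
  ... | no  i≮N = ⊥-elim (i≮N (Fin.toℕ<n i))

  fromFin-fromℕ< : ∀ {N} (f : Fin N → ℕ) {k} (k<N : k < N) → fromFin f k ≡ f (Fin.fromℕ< k<N)
  fromFin-fromℕ< f {k} k<N = trans (cong (fromFin f) (sym (Fin.toℕ-fromℕ< k<N))) (fromFin-toℕ f (Fin.fromℕ< k<N))

  fromFin-strictlyDecreasing : ∀ {N} {f : Fin N → ℕ} → StrictlyDecreasing f → ∀ {i j} → i < j → j < N → fromFin f j < fromFin f i
  fromFin-strictlyDecreasing {N} {f} f↓ {i} {j} i<j j<N =
    subst₂ _<_ (sym (fromFin-fromℕ< f j<N)) (sym (fromFin-fromℕ< f i<N))
           (f↓ (subst₂ _<_ (sym (Fin.toℕ-fromℕ< i<N)) (sym (Fin.toℕ-fromℕ< j<N)) i<j))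
    where
    i<N : i < N
    i<N = ℕ.<-trans i<j j<N

  chain : ∀ {N} (_R_ : ℕ → ℕ → Set) → (∀ {a b c} → a R b → b R c → a R c) → (f : ℕ → ℕ) →
          (∀ k → suc k < N → f (suc k) R f k) → ∀ {i j} → i < j → j < N → f j R f i
  chain _R_ R-trans f step {i} {suc j} (s≤s i≤j) j+1<N with i ≟ j
  ... | yes refl = step i j+1<N
  ... | no  i≢j  = R-trans (step j j+1<N) (chain _R_ R-trans f step (ℕ.≤∧≢⇒< i≤j i≢j) (ℕ.<-trans (ℕ.n<1+n j) j+1<N))

  module _ {N : ℕ} {g : Fin N → ℕ} (g↓ : StrictlyDecreasing g) where

    private
      G : ℕ → ℕ
      G = fromFin g

      G≥ : ∀ d k → k + d < N → d ≤ G k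
      G≥ zero    k _       = z≤n
      G≥ (suc d) k k+d+1<N = ℕ.≤-<-trans (G≥ d (suc k) k+1+d<N)
        (fromFin-strictlyDecreasing g↓ ℕ.≤-refl (ℕ.≤-<-trans (s≤s (ℕ.m≤m+n k d)) k+1+d<N))
        where
        k+1+d<N : suc k + d < N
        k+1+d<N = subst (_< N) (ℕ.+-suc k d) k+d+1<N

      part : ℕ → ℕ
      part k = G k ∸ (N ∸ suc k)

      part-step : ∀ k → suc k < N → part (suc k) ≤ part k
      part-step k k+1<N = subst (λ c → part (suc k) ≤ G k ∸ c) (sym (ℕ.+-∸-assoc 1 k+1<N))
                                (ℕ.∸-monoˡ-≤ (suc (N ∸ suc (suc k))) (fromFin-strictlyDecreasing g↓ ℕ.≤-refl k+1<N))

    fromβ : Vec ℕ N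
    fromβ = Vec.tabulate (λ i → g i ∸ (N ∸ suc (toℕ i)))

    β-fromβ : ∀ i → β fromβ i ≡ g i
    β-fromβ i = begin
      lookup fromβ i + N ∸ suc (toℕ i)                     ≡⟨ cong (λ a → a + N ∸ suc (toℕ i)) (Vec.lookup∘tabulate _ i) ⟩
      g i ∸ (N ∸ suc (toℕ i)) + N ∸ suc (toℕ i)            ≡⟨ ℕ.+-∸-assoc (g i ∸ (N ∸ suc (toℕ i))) (Fin.toℕ<n i) ⟩
      g i ∸ (N ∸ suc (toℕ i)) + (N ∸ suc (toℕ i))          ≡⟨ ℕ.m∸n+n≡m lower ⟩
      g i                                                  ∎
      where
      open ≡.≡-Reasoning
      lower : N ∸ suc (toℕ i) ≤ g i
      lower = subst (N ∸ suc (toℕ i) ≤_) (fromFin-toℕ g i)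
                    (G≥ (N ∸ suc (toℕ i)) (toℕ i) (ℕ.≤-reflexive (ℕ.m+[n∸m]≡n (Fin.toℕ<n i))))

    fromβ-partition : IsPartition fromβ
    fromβ-partition i j i≤j = subst₂ _≤_ (lookup-fromβ j) (lookup-fromβ i) part-antitone
      where
      lookup-fromβ : ∀ i → part (toℕ i) ≡ lookup fromβ i
      lookup-fromβ i = trans (cong (_∸ (N ∸ suc (toℕ i))) (fromFin-toℕ g i)) (sym (Vec.lookup∘tabulate _ i))
      part-antitone : part (toℕ j) ≤ part (toℕ i)
      part-antitone with toℕ i ≟ toℕ j
      ... | yes i≡j = ℕ.≤-reflexive (cong part (sym i≡j))
      ... | no  i≢j = chain _≤_ ℕ.≤-trans part part-step (ℕ.≤∧≢⇒< i≤j i≢j) (Fin.toℕ<n j)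

  DownClosed : ℕ → ∀ {N} → (Fin N → ℕ) → Set
  DownClosed t b = ∀ i → t ≤ b i → ∃[ i' ] b i' + t ≡ b i

  DownClosed-∣ : ∀ {t N} {b : Fin N → ℕ} → DownClosed t b → ∀ i g → g ≤ b i → t ∣ b i ∸ g → ∃[ i' ] b i' ≡ g
  DownClosed-∣ {t} {b = b} closed i g g≤bᵢ (divides q bᵢ-g≡q*t) = descend q i g≤bᵢ bᵢ-g≡q*t
    where
    descend : ∀ q i → g ≤ b i → b i ∸ g ≡ q * t → ∃[ i' ] b i' ≡ g
    descend zero    i g≤bᵢ bᵢ-g≡0 = i , ℕ.≤-antisym (ℕ.m∸n≡0⇒m≤n bᵢ-g≡0) g≤bᵢ
    descend (suc q) i g≤bᵢ bᵢ-g≡t+q*t with closed i t≤bᵢ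
      where
      t≤bᵢ : t ≤ b i
      t≤bᵢ = ℕ.≤-trans (ℕ.m≤m+n t (q * t)) (ℕ.≤-trans (ℕ.≤-reflexive (sym bᵢ-g≡t+q*t)) (ℕ.m∸n≤m (b i) g))
    ... | i' , bᵢ'+t≡bᵢ = descend q i' g≤bᵢ' bᵢ'-g≡q*t
      where
      g+t≤bᵢ : g + t ≤ b i
      g+t≤bᵢ = subst (g + t ≤_) (ℕ.m+[n∸m]≡n g≤bᵢ)
                 (ℕ.+-monoʳ-≤ g (subst (t ≤_) (sym bᵢ-g≡t+q*t) (ℕ.m≤m+n t (q * t))))
      g≤bᵢ' : g ≤ b i'
      g≤bᵢ' = ℕ.+-cancelʳ-≤ t g (b i') (subst (g + t ≤_) (sym bᵢ'+t≡bᵢ) g+t≤bᵢ)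
      bᵢ'-g≡q*t : b i' ∸ g ≡ q * t
      bᵢ'-g≡q*t = begin
        b i' ∸ g              ≡⟨ cong (_∸ g) (ℕ.m+n∸n≡m (b i') t) ⟨
        b i' + t ∸ t ∸ g      ≡⟨ cong (λ x → x ∸ t ∸ g) bᵢ'+t≡bᵢ ⟩
        b i ∸ t ∸ g           ≡⟨ ℕ.∸-+-assoc (b i) t g ⟩
        b i ∸ (t + g)         ≡⟨ cong (b i ∸_) (ℕ.+-comm t g) ⟩
        b i ∸ (g + t)         ≡⟨ ℕ.∸-+-assoc (b i) g t ⟨
        b i ∸ g ∸ t           ≡⟨ cong (_∸ t) bᵢ-g≡t+q*t ⟩
        t + q * t ∸ t         ≡⟨ ℕ.m+n∸m≡n t (q * t) ⟩
        q * t                 ∎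
        where open ≡.≡-Reasoning

  ¬DownClosed⇒hook : ∀ {t N} {b : Fin N → ℕ} → ¬ DownClosed t b → ∃[ p ] t ≤ b p × (∀ i → b i ≢ b p ∸ t)
  ¬DownClosed⇒hook {t} {N} {b} ¬closed
    with Fin.¬∀⟶∃¬ N HasPredecessor (λ i → (t ≤? b i) →-dec Fin.any? (λ i' → b i' + t ≟ b i)) ¬closed
    where
    HasPredecessor : Fin N → Set
    HasPredecessor i = t ≤ b i → ∃[ i' ] b i' + t ≡ b i
  ... | p , no-predecessor with t ≤? b p
  ...   | no  t≰bₚ = ⊥-elim (no-predecessor (⊥-elim ∘ t≰bₚ))
  ...   | yes t≤bₚ = p , t≤bₚ , λ i bᵢ≡bₚ-t → no-predecessor (λ _ → i , trans (cong (_+ t) bᵢ≡bₚ-t) (ℕ.m∸n+n≡m t≤bₚ))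

  module _ (M : ℕ) where

    partOf : ℕ → ℕ → ℕ
    partOf b j = b + suc j ∸ M

    private
      suc-a≤M : ∀ a n → a + suc n ≡ M → suc a ≤ M
      suc-a≤M a n a+n+1≡M = subst (suc a ≤_) a+n+1≡M (subst (_≤ a + suc n) (ℕ.+-comm a 1) (ℕ.+-monoʳ-≤ a (s≤s z≤n)))

      partOf-β : ∀ x a n → a + suc n ≡ M → partOf (x + M ∸ suc a) a ≡ x
      partOf-β x a n a+n+1≡M = begin
        x + M ∸ suc a + suc a ∸ M      ≡⟨ cong (λ y → y + suc a ∸ M) (ℕ.+-∸-assoc x (suc-a≤M a n a+n+1≡M)) ⟩
        x + (M ∸ suc a) + suc a ∸ M    ≡⟨ cong (_∸ M) (ℕ.+-assoc x (M ∸ suc a) (suc a)) ⟩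
        x + (M ∸ suc a + suc a) ∸ M    ≡⟨ cong (λ y → x + y ∸ M) (ℕ.m∸n+n≡m (suc-a≤M a n a+n+1≡M)) ⟩
        x + M ∸ M                      ≡⟨ ℕ.m+n∸n≡m x M ⟩
        x                              ∎
        where open ≡.≡-Reasoning

      β-partOf : ∀ x c a n → a + suc n ≡ M → n ≤ c → partOf c a ≡ x → x + M ∸ suc a ≡ c
      β-partOf x c a n a+n+1≡M n≤c c+a+1-M≡x = trans (cong (_∸ suc a) x+M≡c+a+1) (ℕ.m+n∸n≡m c (suc a))
        where
        M≤c+a+1 : M ≤ c + suc a
        M≤c+a+1 = subst (_≤ c + suc a) (trans (ℕ.+-suc n a) (trans (cong suc (ℕ.+-comm n a)) (trans (sym (ℕ.+-suc a n)) a+n+1≡M)))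
                        (ℕ.+-monoˡ-≤ (suc a) n≤c)
        x+M≡c+a+1 : x + M ≡ c + suc a
        x+M≡c+a+1 = trans (cong (_+ M) (sym c+a+1-M≡x)) (ℕ.m∸n+n≡m M≤c+a+1)

    zipWith-partOf-β : ∀ {n} (xs : Vec ℕ n) (f : ℕ → ℕ) a → (∀ k → f k ≡ a + k) → a + n ≡ M →
      zipWith partOf (tabulate (λ i → lookup xs i + M ∸ suc (f (toℕ i)))) (applyUpTo f n) ≡ toList xs
    zipWith-partOf-β Vec.[]         f a f≗a+ a+0≡M = refl
    zipWith-partOf-β {suc n} (x Vec.∷ xs) f a f≗a+ a+n+1≡M = cong₂ _∷_
      (trans (cong (λ y → partOf (x + M ∸ suc y) y) (trans (f≗a+ 0) (ℕ.+-identityʳ a))) (partOf-β x a n a+n+1≡M))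
      (zipWith-partOf-β xs (f ∘ suc) (suc a) (λ k → trans (f≗a+ (suc k)) (ℕ.+-suc a k)) (trans (sym (ℕ.+-suc a n)) a+n+1≡M))

    zipWith-partOf⇒β∈ : ∀ {n} (xs : Vec ℕ n) (f : ℕ → ℕ) a → (∀ k → f k ≡ a + k) → a + n ≡ M → ∀ {cs} → Descending cs →
      zipWith partOf cs (applyUpTo f n) ≡ toList xs → ∀ i → lookup xs i + M ∸ suc (f (toℕ i)) ∈ cs
    zipWith-partOf⇒β∈ {suc n} (x Vec.∷ xs) f a f≗a+ a+n+1≡M {c ∷ cs} (c> ∷ cs↓) zip≡ i with List.∷-injective zip≡
    ... | head≡ , tail≡ = go i
      where
      n≤|cs| : n ≤ length cs
      n≤|cs| = ℕ.≤-trans (ℕ.≤-reflexive (sym (trans (cong length tail≡) (Vec.length-toList xs))))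
                         (ℕ.≤-trans (ℕ.≤-reflexive (List.length-zipWith partOf cs _)) (ℕ.m⊓n≤m _ _))
      f0≡a : f 0 ≡ a
      f0≡a = trans (f≗a+ 0) (ℕ.+-identityʳ a)
      go : ∀ i → lookup (x Vec.∷ xs) i + M ∸ suc (f (toℕ i)) ∈ c ∷ cs
      go Fin.zero    = here (trans (cong (λ y → x + M ∸ suc y) f0≡a)
                          (β-partOf x c a n a+n+1≡M (ℕ.≤-trans n≤|cs| (Descending-head (c> ∷ cs↓)))
                            (trans (cong (partOf c) (sym f0≡a)) head≡)))
      go (Fin.suc i) = there (zipWith-partOf⇒β∈ xs (f ∘ suc) (suc a) (λ k → trans (f≗a+ (suc k)) (ℕ.+-suc a k))
                                (trans (sym (ℕ.+-suc a n)) a+n+1≡M) cs↓ tail≡ i)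

  module _ {t : ℕ} .{{_ : NonZero t}} where

    [t*j+r]%t≡r : ∀ j {r} → r < t → (t * j + r) % t ≡ r
    [t*j+r]%t≡r j {r} r<t = trans (cong (_% t) (trans (ℕ.+-comm (t * j) r) (cong (r +_) (ℕ.*-comm t j))))
                                   (trans ([m+kn]%n≡m%n r j t) (m<n⇒m%n≡m r<t))

    t*j+r-injective : ∀ {j j' r r'} → t * j + r ≡ t * j' + r' → r < t → r' < t → r ≡ r' × j ≡ j'
    t*j+r-injective {j} {j'} {r} {r'} eq r<t r'<t =
      r≡r' , ℕ.*-cancelˡ-≡ j j' t (ℕ.+-cancelʳ-≡ r (t * j) (t * j') (trans eq (cong (t * j' +_) (sym r≡r'))))
      where
      r≡r' : r ≡ r'
      r≡r' = trans (sym ([t*j+r]%t≡r j r<t)) (trans (cong (_% t) eq) ([t*j+r]%t≡r j' r'<t))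

    t*[m/t]+m%t : ∀ m → m ≡ t * (m / t) + m % t
    t*[m/t]+m%t m = trans (m≡m%n+[m/n]*n m t) (trans (ℕ.+-comm (m % t) _) (cong (_+ m % t) (ℕ.*-comm (m / t) t)))

    module TCore {M : ℕ} {lam : Vec ℕ M} (part : IsPartition lam) where

      count : ℕ → ℕ
      count = countRes t (betas t lam)

      runner : ℕ → List ℕ
      runner r = map (λ j → t * j + r) (upTo (count r))

      flushedBeads : List ℕ
      flushedBeads = concatMap runner (upTo t)

      withResidue : ℕ → List ℕ
      withResidue r = filter (λ b → b % t ≟ r) (betas t lam)

      ∈-runner⁺ : ∀ {j r} → j < count r → t * j + r ∈ runner r
      ∈-runner⁺ {r = r} j<n = ∈.∈-map⁺ (λ j → t * j + r) (∈.∈-upTo⁺ j<n)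

      ∈-flushedBeads⁻ : ∀ {y} → y ∈ flushedBeads → ∃₂ λ j r → r < t × j < count r × y ≡ t * j + r
      ∈-flushedBeads⁻ y∈ with find (∈.∈-concatMap⁻ runner {xs = upTo t} y∈)
      ... | r , r∈ , y∈runner with ∈.∈-map⁻ (λ j → t * j + r) y∈runner
      ... | j , j∈ , y≡ = j , r , ∈.∈-upTo⁻ r∈ , ∈.∈-upTo⁻ j∈ , y≡

      ∈-flushedBeads⁺ : ∀ {j r} → r < t → j < count r → t * j + r ∈ flushedBeads
      ∈-flushedBeads⁺ r<t j<n = ∈.∈-concatMap⁺ runner {xs = upTo t} (lose (∈.∈-upTo⁺ r<t) (∈-runner⁺ j<n))

      flushedBeads-unique : Unique flushedBeads
      flushedBeads-unique = AllPairs.concat⁺ runners-unique runners-disjoint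
        where
        runner-unique : ∀ {r} → r < t → Unique (runner r)
        runner-unique {r} r<t = subst Unique (sym (List.map-upTo (λ j → t * j + r) (count r)))
          (AllPairs.applyUpTo⁺₁ (λ j → t * j + r) (count r) (λ i<j _ eq → ℕ.<⇒≢ i<j (proj₂ (t*j+r-injective eq r<t r<t))))
        runners-unique : All Unique (map runner (upTo t))
        runners-unique = All.tabulate λ xs∈ → let (r , r∈ , xs≡) = ∈.∈-map⁻ runner xs∈ in
                                               subst Unique (sym xs≡) (runner-unique (∈.∈-upTo⁻ r∈))
        disjoint : ∀ {r r'} → r < r' → r' < t → All (λ x → All (x ≢_) (runner r')) (runner r)
        disjoint {r} {r'} r<r' r'<t = All.tabulate λ x∈ → All.tabulate λ y∈ x≡y →
          let (a , _ , x≡) = ∈.∈-map⁻ (λ j → t * j + r) x∈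
              (b , _ , y≡) = ∈.∈-map⁻ (λ j → t * j + r') y∈
          in ℕ.<⇒≢ r<r' (proj₁ (t*j+r-injective (trans (sym x≡) (trans x≡y y≡)) (ℕ.<-trans r<r' r'<t) r'<t))
        runners-disjoint : AllPairs (λ xs ys → All (λ x → All (x ≢_) ys) xs) (map runner (upTo t))
        runners-disjoint = AllPairs.map⁺ (AllPairs.applyUpTo⁺₁ id t disjoint)

      betas≡ : betas t lam ≡ tabulate (β lam)
      betas≡ = List.map-tabulate id (β lam)

      betas-descending : Descending (betas t lam)
      betas-descending = subst Descending (sym betas≡) (AllPairs.tabulate⁺-< (β-strictlyDecreasing lam part))

      ∈-betas⁻ : ∀ {v} → v ∈ betas t lam → ∃[ i ] β lam i ≡ v
      ∈-betas⁻ v∈ = let (i , _ , v≡) = ∈.∈-map⁻ (β lam) v∈ in i , sym v≡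

      ∈-betas⁺ : ∀ i → β lam i ∈ betas t lam
      ∈-betas⁺ i = ∈.∈-map⁺ (β lam) (∈.∈-allFin i)

      withResidue⊆runner : (∀ i → β lam i ∈ flushedBeads) → ∀ r → withResidue r ⊆ runner r
      withResidue⊆runner betas⊆ r {v} v∈ with ∈.∈-filter⁻ (λ b → b % t ≟ r) {xs = betas t lam} v∈
      ... | v∈β , v%t≡r with ∈-betas⁻ v∈β
      ... | i , refl with ∈-flushedBeads⁻ (betas⊆ i)
      ... | j , r' , r'<t , j<n , βᵢ≡ = subst (_∈ runner r) (sym βᵢ≡) (subst (λ x → t * j + r' ∈ runner x) r'≡r (∈-runner⁺ j<n))
        where
        r'≡r : r' ≡ r
        r'≡r = trans (sym ([t*j+r]%t≡r j r'<t)) (trans (cong (_% t) (sym βᵢ≡)) v%t≡r)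

      withResidue-unique : ∀ r → Unique (withResidue r)
      withResidue-unique r = AllPairs.filter⁺ (λ b → b % t ≟ r) (Descending⇒Unique betas-descending)

      flushedBeads⊆betas : (∀ i → β lam i ∈ flushedBeads) → flushedBeads ⊆ betas t lam
      flushedBeads⊆betas betas⊆ {y} y∈ with ∈-flushedBeads⁻ y∈ | y ∈? betas t lam
      ... | _                        | yes y∈β = y∈β
      ... | j , r , r<t , j<n , refl | no  y∉β = ⊥-elim (ℕ.<-irrefl refl (begin-strict
        count r                      ≡⟨⟩
        length (withResidue r)       <⟨ length-mono-⊆ (y∉withResidue ∷ withResidue-unique r) y∷withResidue⊆runner ⟩
        length (runner r)            ≡⟨ trans (List.length-map _ (upTo (count r))) (List.length-upTo (count r)) ⟩
        count r                      ∎))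
        where
        open ℕ.≤-Reasoning
        y∉withResidue : All (t * j + r ≢_) (withResidue r)
        y∉withResidue = All.tabulate λ v∈ y≡v →
          y∉β (subst (_∈ betas t lam) (sym y≡v) (proj₁ (∈.∈-filter⁻ (λ b → b % t ≟ r) {xs = betas t lam} v∈)))
        y∷withResidue⊆runner : t * j + r ∷ withResidue r ⊆ runner r
        y∷withResidue⊆runner (here refl) = ∈-runner⁺ j<n
        y∷withResidue⊆runner (there v∈) = withResidue⊆runner betas⊆ r v∈

      multiples⊆withResidue : DownClosed t (β lam) → ∀ i →
                              applyUpTo (λ j → t * j + β lam i % t) (suc (β lam i / t)) ⊆ withResidue (β lam i % t)
      multiples⊆withResidue closed i v∈ with ∈.∈-applyUpTo⁻ (λ j → t * j + β lam i % t) v∈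
      ... | j' , j'<j+1 , refl with DownClosed-∣ closed i (t * j' + r) v≤y (divides (j ∸ j') y-v≡[j-j']*t)
        where
        y r j : ℕ
        y = β lam i
        r = y % t
        j = y / t
        v≤y : t * j' + r ≤ y
        v≤y = subst (t * j' + r ≤_) (sym (t*[m/t]+m%t y)) (ℕ.+-monoˡ-≤ r (ℕ.*-monoʳ-≤ t (ℕ.≤-pred j'<j+1)))
        y-v≡[j-j']*t : y ∸ (t * j' + r) ≡ (j ∸ j') * t
        y-v≡[j-j']*t = begin
          y ∸ (t * j' + r)                ≡⟨ cong (_∸ (t * j' + r)) (t*[m/t]+m%t y) ⟩
          (t * j + r) ∸ (t * j' + r)      ≡⟨ cong₂ _∸_ (ℕ.+-comm (t * j) r) (ℕ.+-comm (t * j') r) ⟩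
          (r + t * j) ∸ (r + t * j')      ≡⟨ ℕ.[m+n]∸[m+o]≡n∸o r (t * j) (t * j') ⟩
          t * j ∸ t * j'                  ≡⟨ ℕ.*-distribˡ-∸ t j j' ⟨
          t * (j ∸ j')                    ≡⟨ ℕ.*-comm t (j ∸ j') ⟩
          (j ∸ j') * t                    ∎
          where open ≡.≡-Reasoning
      ... | i' , βᵢ'≡v = ∈.∈-filter⁺ (λ b → b % t ≟ β lam i % t) {xs = betas t lam}
                           (subst (_∈ betas t lam) βᵢ'≡v (∈-betas⁺ i')) ([t*j+r]%t≡r j' (m%n<n (β lam i) t))

      DownClosed⇒betas⊆flushedBeads : DownClosed t (β lam) → ∀ i → β lam i ∈ flushedBeads
      DownClosed⇒betas⊆flushedBeads closed i = subst (_∈ flushedBeads) (sym (t*[m/t]+m%t y)) (∈-flushedBeads⁺ r<t j<n)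
        where
        y r : ℕ
        y = β lam i
        r = y % t
        r<t : r < t
        r<t = m%n<n y t
        multiples-unique : Unique (applyUpTo (λ j → t * j + r) (suc (y / t)))
        multiples-unique = AllPairs.applyUpTo⁺₁ (λ j → t * j + r) (suc (y / t)) (λ a<b _ eq → ℕ.<⇒≢ a<b (proj₂ (t*j+r-injective eq r<t r<t)))
        j<n : y / t < count r
        j<n = subst (_≤ count r) (List.length-applyUpTo (λ j → t * j + r) (suc (y / t)))
                    (length-mono-⊆ multiples-unique (multiples⊆withResidue closed i))

      coreBetas≡betas : (∀ i → β lam i ∈ flushedBeads) → coreBetas t lam ≡ betas t lam
      coreBetas≡betas betas⊆ = Descending-ext (sortDec-descending flushedBeads-unique) betas-descending
        (λ v∈ → flushedBeads⊆betas betas⊆ (∈-sortDec⁻ flushedBeads v∈))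
        (λ v∈ → let (i , βᵢ≡v) = ∈-betas⁻ v∈ in subst (_∈ coreBetas t lam) βᵢ≡v (∈-sortDec⁺ flushedBeads (betas⊆ i)))

      DownClosed⇒IsTCore : DownClosed t (β lam) → IsTCore t lam
      DownClosed⇒IsTCore closed = begin
        zipWith (partOf M) (coreBetas t lam) (upTo M)  ≡⟨ cong (λ bs → zipWith (partOf M) bs (upTo M)) coreBetas≡ ⟩
        zipWith (partOf M) (betas t lam) (upTo M)      ≡⟨ cong (λ bs → zipWith (partOf M) bs (upTo M)) betas≡ ⟩
        zipWith (partOf M) (tabulate (β lam)) (upTo M) ≡⟨ zipWith-partOf-β M lam id 0 (λ _ → refl) refl ⟩
        toList lam                                     ∎
        where
        open ≡.≡-Reasoning
        coreBetas≡ : coreBetas t lam ≡ betas t lam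
        coreBetas≡ = coreBetas≡betas (DownClosed⇒betas⊆flushedBeads closed)

      IsTCore⇒betas⊆flushedBeads : IsTCore t lam → ∀ i → β lam i ∈ flushedBeads
      IsTCore⇒betas⊆flushedBeads core i = ∈-sortDec⁻ flushedBeads
        (zipWith-partOf⇒β∈ M lam id 0 (λ _ → refl) refl (sortDec-descending flushedBeads-unique) core i)

      IsTCore⇒DownClosed : IsTCore t lam → DownClosed t (β lam)
      IsTCore⇒DownClosed core i t≤βᵢ = predecessor (∈-flushedBeads⁻ (IsTCore⇒betas⊆flushedBeads core i))
        where
        predecessor : (∃₂ λ j r → r < t × j < count r × β lam i ≡ t * j + r) → ∃[ i' ] β lam i' + t ≡ β lam i
        predecessor (zero  , r , r<t , _     , βᵢ≡) =
          ⊥-elim (ℕ.<⇒≱ r<t (subst (t ≤_) (trans βᵢ≡ (cong (_+ r) (ℕ.*-zeroʳ t))) t≤βᵢ))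
        predecessor (suc j , r , r<t , j+1<n , βᵢ≡) =
          let (i' , βᵢ'≡) = ∈-betas⁻ (flushedBeads⊆betas (IsTCore⇒betas⊆flushedBeads core)
                                        (∈-flushedBeads⁺ r<t (ℕ.<-trans (ℕ.n<1+n j) j+1<n)))
          in i' , (begin
            β lam i' + t          ≡⟨ cong (_+ t) βᵢ'≡ ⟩
            t * j + r + t         ≡⟨ ℕ.+-comm (t * j + r) t ⟩
            t + (t * j + r)       ≡⟨ ℕ.+-assoc t (t * j) r ⟨
            t + t * j + r         ≡⟨ cong (_+ r) (ℕ.*-suc t j) ⟨
            t * suc j + r         ≡⟨ βᵢ≡ ⟨
            β lam i               ∎)
          where open ≡.≡-Reasoning

open BetaNumbers

module Transversals where

  open import Data.Nat using (_+_; _*_)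
  open ≡ using (refl; sym; trans; cong; cong₂; subst; subst₂)

  injective-below⇒≗id : ∀ {N} {τ : Fin N → Fin N} → Injective _≡_ _≡_ τ → (∀ i → toℕ (τ i) ≤ toℕ i) → ∀ i → τ i ≡ i
  injective-below⇒≗id {τ = τ} τ-inj τ≤ i = go (suc (toℕ i)) i ℕ.≤-refl
    where
    go : ∀ n i → toℕ i < n → τ i ≡ i
    go (suc n) i i<n+1 with τ i Fin.≟ i
    ... | yes τᵢ≡i = τᵢ≡i
    ... | no  τᵢ≢i = ⊥-elim (τᵢ≢i (τ-inj (go n (τ i) (ℕ.<-≤-trans τᵢ<i (ℕ.≤-pred i<n+1)))))
      where
      τᵢ<i : toℕ (τ i) < toℕ i
      τᵢ<i = ℕ.≤∧≢⇒< (τ≤ i) (τᵢ≢i ∘ Fin.toℕ-injective)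

  Reaches : ℕ → ∀ {N} → (Fin N → ℕ) → (Fin N → ℕ) → Fin N → Fin N → Set
  Reaches t b γ i j = γ j ≤ b i × t ∣ b i ∸ γ j

  module _ {t N : ℕ} {b γ : Fin N → ℕ} (closed : DownClosed t b) (γ↓ : StrictlyDecreasing γ) (γ≤b : ∀ i → γ i ≤ b i)
           {τ : Fin N → Fin N} (τ-inj : Injective _≡_ _≡_ τ) (τ-reaches : ∀ i → Reaches t b γ i (τ i)) where

    private
      γ∘τ≗b : ∀ i → γ (τ i) ≡ b i
      γ∘τ≗b i = go (suc (b i)) i ℕ.≤-refl
        where
        go : ∀ n i → b i < n → γ (τ i) ≡ b i
        go (suc n) i bᵢ<n+1 with γ (τ i) ≟ b i
        ... | yes eq = eq
        ... | no  γτᵢ≢bᵢ with DownClosed-∣ closed i (γ (τ i)) (proj₁ (τ-reaches i)) (proj₂ (τ-reaches i))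
        ... | i' , bᵢ'≡γτᵢ = ⊥-elim (ℕ.<⇒≢ bᵢ'<bᵢ (cong b i'≡i))
          where
          bᵢ'<bᵢ : b i' < b i
          bᵢ'<bᵢ = subst (_< b i) (sym bᵢ'≡γτᵢ) (ℕ.≤∧≢⇒< (proj₁ (τ-reaches i)) γτᵢ≢bᵢ)
          i'≡i : i' ≡ i
          i'≡i = τ-inj (StrictlyDecreasing⇒injective γ↓ (trans (go n i' (ℕ.<-≤-trans bᵢ'<bᵢ (ℕ.≤-pred bᵢ<n+1))) bᵢ'≡γτᵢ))

      τ-below : ∀ i → toℕ (τ i) ≤ toℕ i
      τ-below i with toℕ (τ i) ≤? toℕ i
      ... | yes τᵢ≤i = τᵢ≤i
      ... | no  τᵢ≰i = ⊥-elim (ℕ.<⇒≱ (γ↓ (ℕ.≰⇒> τᵢ≰i)) (subst (γ i ≤_) (sym (γ∘τ≗b i)) (γ≤b i)))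

    reaching-transversal⇒≗ : γ ≗ b
    reaching-transversal⇒≗ i = trans (cong γ (sym (injective-below⇒≗id τ-inj τ-below i))) (γ∘τ≗b i)

  ∣∧<⇒≡0 : ∀ {t d} → t ∣ d → d < t → d ≡ 0
  ∣∧<⇒≡0 {d = zero}  _   _   = refl
  ∣∧<⇒≡0 {d = suc d} t∣d d<t = ⊥-elim (ℕ.<⇒≱ d<t (∣⇒≤ t∣d))

  module _ {t N : ℕ} {b γ target : Fin N → ℕ} {p : Fin N} {x : ℕ}
           (b-inj : Injective _≡_ _≡_ b) (γ-inj : Injective _≡_ _≡_ γ)
           (target≗b : ∀ i → i ≢ p → target i ≡ b i) (targetₚ≡x : target p ≡ x) (x+t≡bₚ : x + t ≡ b p) (x∉b : ∀ i → b i ≢ x)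
           (ρ : Fin N → Fin N) (target∘ρ≗γ : ∀ j → target (ρ j) ≡ γ j)
           {τ : Fin N → Fin N} (τ-inj : Injective _≡_ _≡_ τ) (τ-reaches : ∀ i → Reaches t b γ i (τ i)) where

    reaching-transversal⇒γ∘τ≗target : ∀ i → γ (τ i) ≡ target i
    reaching-transversal⇒γ∘τ≗target i = go (suc (b i)) i ℕ.≤-refl
      where
      go : ∀ n i → b i < n → γ (τ i) ≡ target i
      go (suc n) i bᵢ<n+1 with ρ (τ i) Fin.≟ i | ℕ.<-cmp (b (ρ (τ i))) (b i)
      ... | yes i'≡i | _ = trans (sym (target∘ρ≗γ (τ i))) (cong target i'≡i)
      ... | no  i'≢i | tri< bᵢ'<bᵢ _ _ =
        ⊥-elim (i'≢i (τ-inj (γ-inj (trans (go n (ρ (τ i)) (ℕ.<-≤-trans bᵢ'<bᵢ (ℕ.≤-pred bᵢ<n+1))) (target∘ρ≗γ (τ i))))))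
      ... | no  i'≢i | tri≈ _ bᵢ'≡bᵢ _ = ⊥-elim (i'≢i (b-inj bᵢ'≡bᵢ))
      ... | no  _    | tri> _ _ bᵢ<bᵢ' with ρ (τ i) Fin.≟ p
      ...   | no  i'≢p = ⊥-elim (ℕ.<⇒≱ bᵢ<bᵢ' (subst (_≤ b i) (trans (sym (target∘ρ≗γ (τ i))) (target≗b _ i'≢p)) (proj₁ (τ-reaches i))))
      ...   | yes i'≡p = ⊥-elim (x∉b i (ℕ.≤-antisym (ℕ.m∸n≡0⇒m≤n bᵢ-x≡0) x≤bᵢ))
        where
        γτᵢ≡x : γ (τ i) ≡ x
        γτᵢ≡x = trans (sym (target∘ρ≗γ (τ i))) (trans (cong target i'≡p) targetₚ≡x)
        x≤bᵢ : x ≤ b i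
        x≤bᵢ = subst (_≤ b i) γτᵢ≡x (proj₁ (τ-reaches i))
        bᵢ<x+t : b i < x + t
        bᵢ<x+t = subst (b i <_) (trans (cong b i'≡p) (sym x+t≡bₚ)) bᵢ<bᵢ'
        bᵢ-x≡0 : b i ∸ x ≡ 0
        bᵢ-x≡0 = ∣∧<⇒≡0 (subst (λ g → t ∣ b i ∸ g) γτᵢ≡x (proj₂ (τ-reaches i)))
                         (ℕ.+-cancelʳ-< x (b i ∸ x) t (subst (_< t + x) (sym (ℕ.m∸n+n≡m x≤bᵢ)) (subst (b i <_) (ℕ.+-comm x t) bᵢ<x+t)))

  -- γ is the decreasing rearrangement of b with b p replaced by x = b p - t: the entries after
  -- position p move up by one until x fits in, at the last position q with x < b q.
  module HookRemoval {N t : ℕ} (t≥1 : 1 ≤ t) {b : Fin N → ℕ} (b↓ : StrictlyDecreasing b)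
                     (p : Fin N) (t≤bₚ : t ≤ b p) (x∉b : ∀ i → b i ≢ b p ∸ t) where

    x : ℕ
    x = b p ∸ t

    private
      B : ℕ → ℕ
      B = fromFin b

      P : ℕ
      P = toℕ p

      P<N : P < N
      P<N = Fin.toℕ<n p

      B↓ : ∀ {i j} → i < j → j < N → B j < B i
      B↓ = fromFin-strictlyDecreasing b↓

      B-antitone : ∀ {i j} → i ≤ j → j < N → B j ≤ B i
      B-antitone {i} {j} i≤j j<N with i ≟ j
      ... | yes refl = ℕ.≤-refl
      ... | no  i≢j  = ℕ.<⇒≤ (B↓ (ℕ.≤∧≢⇒< i≤j i≢j) j<N)

      x∉B : ∀ {k} → k < N → B k ≢ x
      x∉B k<N Bₖ≡x = x∉b (Fin.fromℕ< k<N) (trans (sym (fromFin-fromℕ< b k<N)) Bₖ≡x)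

      x<B-P : x < B P
      x<B-P = subst (x <_) (sym (fromFin-toℕ b p)) (ℕ.∸-monoʳ-< {b p} {t} {0} t≥1 t≤bₚ)

      last-above : ∀ d i → suc (i + d) ≡ N → x < B i →
                   ∃[ q ] (i ≤ q × q < N × x < B q × (∀ {j} → q < j → j < N → B j < x))
      last-above zero    i i+1≡N x<Bᵢ = i , ℕ.≤-refl , i<N , x<Bᵢ , λ i<j j<N → ⊥-elim (ℕ.<⇒≱ j<N (subst (_≤ _) i+1≡N' i<j))
        where
        i+1≡N' : suc i ≡ N
        i+1≡N' = trans (cong suc (sym (ℕ.+-identityʳ i))) i+1≡N
        i<N : i < N
        i<N = subst (i <_) i+1≡N' ℕ.≤-refl
      last-above (suc d) i i+d+2≡N x<Bᵢ with x <? B (suc i)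
      ... | yes x<Bᵢ₊₁ = let (q , i+1≤q , rest) = last-above d (suc i) (trans (cong suc (sym (ℕ.+-suc i d))) i+d+2≡N) x<Bᵢ₊₁
                         in q , ℕ.<⇒≤ i+1≤q , rest
      ... | no  x≮Bᵢ₊₁ = i , ℕ.≤-refl , i<N , x<Bᵢ , λ i<j j<N →
            ℕ.≤∧≢⇒< (ℕ.≤-trans (B-antitone i<j j<N) (ℕ.≮⇒≥ x≮Bᵢ₊₁)) (x∉B j<N)
        where
        i<N : i < N
        i<N = subst (i <_) i+d+2≡N (s≤s (ℕ.m≤m+n i (suc d)))

      threshold : ∃[ q ] (P ≤ q × q < N × x < B q × (∀ {j} → q < j → j < N → B j < x))
      threshold = last-above (N ∸ suc P) P (ℕ.m+[n∸m]≡n P<N) x<B-P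

      q : ℕ
      q = proj₁ threshold

      P≤q : P ≤ q
      P≤q = proj₁ (proj₂ threshold)

      q<N : q < N
      q<N = proj₁ (proj₂ (proj₂ threshold))

      x<B-q : x < B q
      x<B-q = proj₁ (proj₂ (proj₂ (proj₂ threshold)))

      B<x : ∀ {j} → q < j → j < N → B j < x
      B<x = proj₂ (proj₂ (proj₂ (proj₂ threshold)))

      x<B : ∀ {i} → i ≤ q → x < B i
      x<B i≤q = ℕ.<-≤-trans x<B-q (B-antitone i≤q q<N)

      data Position (j : ℕ) : Set where
        left   : j < P → Position j
        middle : P ≤ j → j < q → Position j
        hole   : j ≡ q → Position j
        right  : q < j → Position j

      position : ∀ j → Position j
      position j with j <? P | j <? q | j ≟ q
      ... | yes j<P | _       | _       = left j<P
      ... | no  j≮P | yes j<q | _       = middle (ℕ.≮⇒≥ j≮P) j<q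
      ... | no  _   | no  _   | yes j≡q = hole j≡q
      ... | no  _   | no  j≮q | no  j≢q = right (ℕ.≤∧≢⇒< (ℕ.≮⇒≥ j≮q) (j≢q ∘ sym))

      value : ∀ {j} → Position j → ℕ
      value {j} (left _)     = B j
      value {j} (middle _ _) = B (suc j)
      value     (hole _)     = x
      value {j} (right _)    = B j

      value-irrelevant : ∀ {j} (c d : Position j) → value c ≡ value d
      value-irrelevant (left _)       (left _)        = refl
      value-irrelevant (middle _ _)   (middle _ _)    = refl
      value-irrelevant (hole _)       (hole _)        = refl
      value-irrelevant (right _)      (right _)       = refl
      value-irrelevant (left j<P)     (middle P≤j _)  = ⊥-elim (ℕ.<⇒≱ j<P P≤j)
      value-irrelevant (middle P≤j _) (left j<P)      = ⊥-elim (ℕ.<⇒≱ j<P P≤j)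
      value-irrelevant (left j<P)     (hole refl)     = ⊥-elim (ℕ.<⇒≱ j<P P≤q)
      value-irrelevant (hole refl)    (left j<P)      = ⊥-elim (ℕ.<⇒≱ j<P P≤q)
      value-irrelevant (left j<P)     (right q<j)     = ⊥-elim (ℕ.<-asym j<P (ℕ.≤-<-trans P≤q q<j))
      value-irrelevant (right q<j)    (left j<P)      = ⊥-elim (ℕ.<-asym j<P (ℕ.≤-<-trans P≤q q<j))
      value-irrelevant (middle _ j<q) (hole refl)     = ⊥-elim (ℕ.<-irrefl refl j<q)
      value-irrelevant (hole refl)    (middle _ j<q)  = ⊥-elim (ℕ.<-irrefl refl j<q)
      value-irrelevant (middle _ j<q) (right q<j)     = ⊥-elim (ℕ.<-asym j<q q<j)
      value-irrelevant (right q<j)    (middle _ j<q)  = ⊥-elim (ℕ.<-asym j<q q<j)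
      value-irrelevant (hole refl)    (right q<j)     = ⊥-elim (ℕ.<-irrefl refl q<j)
      value-irrelevant (right q<j)    (hole refl)     = ⊥-elim (ℕ.<-irrefl refl q<j)

      Γ : ℕ → ℕ
      Γ j = value (position j)

      Γ≡value : ∀ {j} (c : Position j) → Γ j ≡ value c
      Γ≡value {j} = value-irrelevant (position j)

      value-step : ∀ {j} → suc j < N → (c : Position j) (d : Position (suc j)) → value d < value c
      value-step j+1<N (left _)       (left _)            = B↓ ℕ.≤-refl j+1<N
      value-step j+1<N (left _)       (middle _ j+1<q)    = B↓ (s≤s (ℕ.n≤1+n _)) (ℕ.≤-<-trans j+1<q q<N)
      value-step j+1<N (left j<P)     (hole _)            = x<B (ℕ.<⇒≤ (ℕ.<-≤-trans j<P P≤q))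
      value-step j+1<N (left j<P)     (right q<j+1)       = ⊥-elim (ℕ.<⇒≱ j<P (ℕ.≤-trans P≤q (ℕ.≤-pred q<j+1)))
      value-step j+1<N (middle P≤j _) (left j+1<P)        = ⊥-elim (ℕ.<⇒≱ j+1<P (ℕ.≤-trans P≤j (ℕ.n≤1+n _)))
      value-step j+1<N (middle _ _)   (middle _ j+1<q)    = B↓ ℕ.≤-refl (ℕ.≤-<-trans j+1<q q<N)
      value-step j+1<N (middle _ _)   (hole j+1≡q)        = x<B (ℕ.≤-reflexive j+1≡q)
      value-step j+1<N (middle _ j<q) (right q<j+1)       = ⊥-elim (ℕ.<⇒≱ j<q (ℕ.≤-pred q<j+1))
      value-step j+1<N (hole j≡q)     (left j+1<P)        =
        ⊥-elim (ℕ.<⇒≱ j+1<P (ℕ.≤-trans P≤q (ℕ.≤-trans (ℕ.≤-reflexive (sym j≡q)) (ℕ.n≤1+n _))))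
      value-step j+1<N (hole j≡q)     (middle _ j+1<q)    = ⊥-elim (ℕ.<⇒≱ j+1<q (ℕ.≤-trans (ℕ.≤-reflexive (sym j≡q)) (ℕ.n≤1+n _)))
      value-step j+1<N (hole j≡q)     (hole j+1≡q)        = ⊥-elim (ℕ.1+n≢n (trans j+1≡q (sym j≡q)))
      value-step j+1<N (hole j≡q)     (right q<j+1)       = B<x q<j+1 j+1<N
      value-step j+1<N (right q<j)    (left j+1<P)        = ⊥-elim (ℕ.<-asym (ℕ.<-trans j+1<P (ℕ.≤-<-trans P≤q q<j)) (ℕ.n<1+n _))
      value-step j+1<N (right q<j)    (middle _ j+1<q)    = ⊥-elim (ℕ.<-asym (ℕ.<-trans j+1<q q<j) (ℕ.n<1+n _))
      value-step j+1<N (right q<j)    (hole j+1≡q)        = ⊥-elim (ℕ.<-asym q<j (subst (_ <_) j+1≡q (ℕ.n<1+n _)))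
      value-step j+1<N (right _)      (right _)           = B↓ ℕ.≤-refl j+1<N

      Γ-step : ∀ j → suc j < N → Γ (suc j) < Γ j
      Γ-step j j+1<N = value-step j+1<N (position j) (position (suc j))

      Γ≤B : ∀ j → j < N → Γ j ≤ B j
      Γ≤B j j<N with position j
      ... | left _         = ℕ.≤-refl
      ... | middle _ j<q   = ℕ.<⇒≤ (B↓ ℕ.≤-refl (ℕ.≤-<-trans j<q q<N))
      ... | hole j≡q       = ℕ.<⇒≤ (x<B (ℕ.≤-reflexive j≡q))
      ... | right _        = ℕ.≤-refl

      Tg : ℕ → ℕ
      Tg i with i ≟ P
      ... | yes _ = x
      ... | no  _ = B i

      Tg-P : Tg P ≡ x
      Tg-P with P ≟ P
      ... | yes _   = refl
      ... | no  P≢P = ⊥-elim (P≢P refl)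

      Tg-≢ : ∀ {i} → i ≢ P → Tg i ≡ B i
      Tg-≢ {i} i≢P with i ≟ P
      ... | yes i≡P = ⊥-elim (i≢P i≡P)
      ... | no  _   = refl

      preimage : ∀ {i} → i < N → ∃[ j ] j < N × Γ j ≡ Tg i
      preimage {i} i<N with ℕ.<-cmp i P
      ... | tri< i<P _ _ = i , i<N , trans (Γ≡value (left i<P)) (sym (Tg-≢ (ℕ.<⇒≢ i<P)))
      ... | tri≈ _ i≡P _ = q , q<N , trans (Γ≡value (hole refl)) (sym (trans (cong Tg i≡P) Tg-P))
      ... | tri> _ _ P<i with i ≤? q
      ...   | no  i≰q = i , i<N , trans (Γ≡value (right (ℕ.≰⇒> i≰q))) (sym (Tg-≢ (ℕ.>⇒≢ P<i)))
      ...   | yes i≤q = shifted P<i i≤q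
        where
        shifted : ∀ {i} → P < i → i ≤ q → ∃[ j ] j < N × Γ j ≡ Tg i
        shifted {suc k} (s≤s P≤k) k<q = k , ℕ.<-trans k<q q<N , trans (Γ≡value (middle P≤k k<q)) (sym (Tg-≢ (ℕ.>⇒≢ (s≤s P≤k))))

      image : ∀ {j} → j < N → ∃[ i ] i < N × Tg i ≡ Γ j
      image {j} j<N with position j
      ... | left j<P       = j , j<N , Tg-≢ (ℕ.<⇒≢ j<P)
      ... | middle P≤j j<q = suc j , ℕ.≤-<-trans j<q q<N , Tg-≢ (ℕ.>⇒≢ (s≤s P≤j))
      ... | hole _         = P , P<N , Tg-P
      ... | right q<j      = j , j<N , Tg-≢ (ℕ.>⇒≢ (ℕ.≤-<-trans P≤q q<j))

    γ : Fin N → ℕ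
    γ i = Γ (toℕ i)

    γ↓ : StrictlyDecreasing γ
    γ↓ {i} {j} i<j = chain _<_ ℕ.<-trans Γ Γ-step i<j (Fin.toℕ<n j)

    γ≤b : ∀ i → γ i ≤ b i
    γ≤b i = subst (γ i ≤_) (fromFin-toℕ b i) (Γ≤B (toℕ i) (Fin.toℕ<n i))

    moved : Fin N
    moved = Fin.fromℕ< q<N

    γ-moved : γ moved ≡ x
    γ-moved = trans (cong Γ (Fin.toℕ-fromℕ< q<N)) (Γ≡value (hole refl))

    target : Fin N → ℕ
    target i = Tg (toℕ i)

    target-p : target p ≡ x
    target-p = Tg-P

    target-≢ : ∀ {i} → i ≢ p → target i ≡ b i
    target-≢ {i} i≢p = trans (Tg-≢ (i≢p ∘ Fin.toℕ-injective)) (fromFin-toℕ b i)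

    σ : Fin N → Fin N
    σ i = Fin.fromℕ< (proj₁ (proj₂ (preimage (Fin.toℕ<n i))))

    γ∘σ≗target : ∀ i → γ (σ i) ≡ target i
    γ∘σ≗target i = let (j , j<N , Γⱼ≡) = preimage (Fin.toℕ<n i) in trans (cong Γ (Fin.toℕ-fromℕ< j<N)) Γⱼ≡

    ρ : Fin N → Fin N
    ρ j = Fin.fromℕ< (proj₁ (proj₂ (image (Fin.toℕ<n j))))

    target∘ρ≗γ : ∀ j → target (ρ j) ≡ γ j
    target∘ρ≗γ j = let (i , i<N , Tᵢ≡) = image (Fin.toℕ<n j) in trans (cong Tg (Fin.toℕ-fromℕ< i<N)) Tᵢ≡

open Transversals

module Powers {c ℓ : Level} (R : CommutativeRing c ℓ) where

  open CommutativeRing R hiding (zero)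
  open Alg R using (pow)
  open import Algebra.Properties.Ring ring using (-1*x≈-x; -‿involutive)
  open import Relation.Binary.Reasoning.Setoid setoid
  open import Tactic.RingSolver.NonReflective (fromCommutativeRing R (λ _ → nothing))
    using (solve; _⊗_; _⊜_)

  pow-+ : ∀ x a b → pow x (a ℕ.+ b) ≈ pow x a * pow x b
  pow-+ x zero    b = sym (*-identityˡ _)
  pow-+ x (suc a) b = trans (*-cong refl (pow-+ x a b)) (sym (*-assoc _ _ _))

  pow-[-1]≉0 : ¬ 1# ≈ 0# → ∀ n → ¬ pow (- 1#) n ≈ 0#
  pow-[-1]≉0 1≉0 n sⁿ≈0 = 1≉0 (begin
    1#                           ≈⟨ pow-[-1]² n ⟨
    pow (- 1#) n * pow (- 1#) n  ≈⟨ *-cong sⁿ≈0 refl ⟩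
    0# * pow (- 1#) n            ≈⟨ zeroˡ _ ⟩
    0#                           ∎)
    where
    pow-[-1]² : ∀ n → pow (- 1#) n * pow (- 1#) n ≈ 1#
    pow-[-1]² zero    = *-identityˡ 1#
    pow-[-1]² (suc n) = trans (solve 2 (λ m p → ((m ⊗ p) ⊗ (m ⊗ p)) ⊜ ((m ⊗ m) ⊗ (p ⊗ p))) refl (- 1#) (pow (- 1#) n))
      (trans (*-cong (trans (-1*x≈-x (- 1#)) (-‿involutive 1#)) (pow-[-1]² n)) (*-identityˡ 1#))

module Sums {c ℓ : Level} (R : CommutativeRing c ℓ) where

  open CommutativeRing R hiding (zero)
  open Alg R using (sumL)
  open import Relation.Binary.Reasoning.Setoid setoid
  open import Tactic.RingSolver.NonReflective (fromCommutativeRing R (λ _ → nothing))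
    using (solve; _⊕_; _⊗_; _⊜_)

  ∑< : ℕ → (ℕ → Carrier) → Carrier
  ∑< zero    f = 0#
  ∑< (suc n) f = f 0 + ∑< n (f ∘ suc)

  syntax ∑< n (λ j → e) = ∑[ j < n ] e

  sumL-applyUpTo : ∀ n f → sumL (applyUpTo f n) ≡ ∑< n f
  sumL-applyUpTo zero    f = ≡.refl
  sumL-applyUpTo (suc n) f = ≡.cong (f 0 +_) (sumL-applyUpTo n (f ∘ suc))

  ∑<-cong : ∀ n {f g} → (∀ j → j < n → f j ≈ g j) → ∑< n f ≈ ∑< n g
  ∑<-cong zero    f≈g = refl
  ∑<-cong (suc n) f≈g = +-cong (f≈g 0 (s≤s z≤n)) (∑<-cong n (λ j j<n → f≈g (suc j) (s≤s j<n)))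

  ∑<-zero : ∀ n {f} → (∀ j → j < n → f j ≈ 0#) → ∑< n f ≈ 0#
  ∑<-zero zero    f≈0 = refl
  ∑<-zero (suc n) f≈0 =
    trans (+-cong (f≈0 0 (s≤s z≤n)) (∑<-zero n (λ j j<n → f≈0 (suc j) (s≤s j<n)))) (+-identityˡ 0#)

  *-distribˡ-∑< : ∀ n a f → a * ∑< n f ≈ ∑[ j < n ] (a * f j)
  *-distribˡ-∑< zero    a f = zeroʳ a
  *-distribˡ-∑< (suc n) a f = trans (distribˡ a (f 0) _) (+-cong refl (*-distribˡ-∑< n a (f ∘ suc)))

  ∑<-distrib-+ : ∀ n f g → ∑[ j < n ] (f j + g j) ≈ ∑< n f + ∑< n g
  ∑<-distrib-+ zero    f g = sym (+-identityˡ 0#)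
  ∑<-distrib-+ (suc n) f g = trans (+-cong refl (∑<-distrib-+ n (f ∘ suc) (g ∘ suc)))
    (solve 4 (λ a b c d → ((a ⊕ b) ⊕ (c ⊕ d)) ⊜ ((a ⊕ c) ⊕ (b ⊕ d))) refl (f 0) (g 0) _ _)

  ∑<-last : ∀ n f → ∑< (suc n) f ≈ ∑< n f + f n
  ∑<-last zero    f = +-comm (f 0) 0#
  ∑<-last (suc n) f = trans (+-cong refl (∑<-last n (f ∘ suc))) (sym (+-assoc (f 0) _ _))

  infixl 7 _⋆_
  _⋆_ : (ℕ → Carrier) → (ℕ → Carrier) → ℕ → Carrier
  (f ⋆ g) k = ∑[ j < suc k ] (f j * g (k ∸ j))

  shift : (ℕ → Carrier) → ℕ → Carrier
  shift f zero    = 0#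
  shift f (suc n) = f n

  ⋆-congʳ : ∀ {f f'} → (∀ j → f j ≈ f' j) → ∀ g k → (f ⋆ g) k ≈ (f' ⋆ g) k
  ⋆-congʳ f≈f' g k = ∑<-cong (suc k) (λ j _ → *-cong (f≈f' j) (refl {g (k ∸ j)}))

  ⋆-congˡ : ∀ f {g g'} → (∀ j → g j ≈ g' j) → ∀ k → (f ⋆ g) k ≈ (f ⋆ g') k
  ⋆-congˡ f g≈g' k = ∑<-cong (suc k) (λ j _ → *-cong (refl {f j}) (g≈g' (k ∸ j)))

  ⋆-distribʳ-+ : ∀ f f' g k → ((λ j → f j + f' j) ⋆ g) k ≈ (f ⋆ g) k + (f' ⋆ g) k
  ⋆-distribʳ-+ f f' g k = trans (∑<-cong (suc k) (λ j _ → distribʳ (g (k ∸ j)) (f j) (f' j)))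
                                (∑<-distrib-+ (suc k) (λ j → f j * g (k ∸ j)) (λ j → f' j * g (k ∸ j)))

  ⋆-distribˡ-+ : ∀ f g g' k → (f ⋆ (λ j → g j + g' j)) k ≈ (f ⋆ g) k + (f ⋆ g') k
  ⋆-distribˡ-+ f g g' k = trans (∑<-cong (suc k) (λ j _ → distribˡ (f j) (g (k ∸ j)) (g' (k ∸ j))))
                                (∑<-distrib-+ (suc k) (λ j → f j * g (k ∸ j)) (λ j → f j * g' (k ∸ j)))

  ⋆-*ˡ : ∀ a f g k → ((λ j → a * f j) ⋆ g) k ≈ a * (f ⋆ g) k
  ⋆-*ˡ a f g k = trans (∑<-cong (suc k) (λ j _ → *-assoc a (f j) (g (k ∸ j))))
                       (sym (*-distribˡ-∑< (suc k) a (λ j → f j * g (k ∸ j))))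

  ⋆-*ʳ : ∀ a f g k → (f ⋆ (λ j → a * g j)) k ≈ a * (f ⋆ g) k
  ⋆-*ʳ a f g k = trans (∑<-cong (suc k) (λ j _ → x*[y*z]≈y*[x*z] (f j) a (g (k ∸ j))))
                       (sym (*-distribˡ-∑< (suc k) a (λ j → f j * g (k ∸ j))))
    where
    x*[y*z]≈y*[x*z] : ∀ x y z → x * (y * z) ≈ y * (x * z)
    x*[y*z]≈y*[x*z] = solve 3 (λ x y z → (x ⊗ (y ⊗ z)) ⊜ (y ⊗ (x ⊗ z))) refl

  shift-⋆ : ∀ f g k → (shift f ⋆ g) (suc k) ≈ (f ⋆ g) k
  shift-⋆ f g k = trans (+-cong (zeroˡ _) refl) (+-identityˡ _)

  ⋆-shift : ∀ f g k → (f ⋆ shift g) (suc k) ≈ (f ⋆ g) k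
  ⋆-shift f g k = begin
    (f ⋆ shift g) (suc k)                                 ≈⟨ ∑<-last (suc k) (λ j → f j * shift g (suc k ∸ j)) ⟩
    ∑[ j < suc k ] (f j * shift g (suc k ∸ j)) + f (suc k) * shift g (suc k ∸ suc k)
                                                          ≈⟨ +-cong (∑<-cong (suc k) shift-inside) last≈0 ⟩
    (f ⋆ g) k + 0#                                        ≈⟨ +-identityʳ _ ⟩
    (f ⋆ g) k                                             ∎
    where
    shift-inside : ∀ j → j < suc k → f j * shift g (suc k ∸ j) ≈ f j * g (k ∸ j)
    shift-inside j j<1+k = reflexive (≡.cong (λ i → f j * shift g i) (ℕ.+-∸-assoc 1 (ℕ.≤-pred j<1+k)))
    last≈0 : f (suc k) * shift g (suc k ∸ suc k) ≈ 0#
    last≈0 = trans (reflexive (≡.cong (λ i → f (suc k) * shift g i) (ℕ.n∸n≡0 k))) (zeroʳ _)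

module SymmetricFunctions {c ℓ : Level} (R : CommutativeRing c ℓ) where

  open CommutativeRing R hiding (zero)
  open Alg R
  open Powers R
  open Sums R
  open import Algebra.Properties.Ring ring using (-1*x≈-x; -‿distribˡ-*; x∙y⁻¹≈ε⇒x≈y)
  open import Relation.Binary.Reasoning.Setoid setoid
  open import Tactic.RingSolver.NonReflective (fromCommutativeRing R (λ _ → nothing))
    using (solve; _⊕_; _⊗_; ⊝_; _⊜_)
  open import Data.List.Relation.Binary.Equality.Setoid setoid using (_≋_; []; _∷_; ≋-refl; ≋-reflexive; ≋-trans)
  open import Data.List.Relation.Binary.Permutation.Setoid setoid using (_↭_; ↭-trans; ↭-reflexive; ↭-reflexive-≋)
  open import Data.List.Relation.Binary.Permutation.Setoid.Properties setoid using (++-comm)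
  import Data.List.Relation.Binary.Permutation.Homogeneous as Perm

  H : List Carrier → ℕ → Carrier
  H zs       zero    = 1#
  H []       (suc k) = 0#
  H (z ∷ zs) (suc k) = H zs (suc k) + z * H (z ∷ zs) k

  E : List Carrier → ℕ → Carrier
  E zs       zero    = 1#
  E []       (suc k) = 0#
  E (z ∷ zs) (suc k) = E zs (suc k) + z * E zs k

  hN≈H : ∀ k zs → hN k zs ≈ H zs k
  hN≈H zero    []       = refl
  hN≈H (suc k) []       = refl
  hN≈H k       (z ∷ zs) = trans (reflexive (≡.trans (unfold k) (sum-upTo (suc k)))) (split k)
    where
    unfold : ∀ k → hN k (z ∷ zs) ≡ sumL (map (λ j → pow z j * hN (k ∸ j) zs) (upTo (suc k)))
    unfold zero    = ≡.refl
    unfold (suc k) = ≡.refl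
    sum-upTo : ∀ n → sumL (map (λ j → pow z j * hN (k ∸ j) zs) (upTo n)) ≡ ∑[ j < n ] (pow z j * hN (k ∸ j) zs)
    sum-upTo n = ≡.trans (≡.cong sumL (List.map-upTo _ n)) (sumL-applyUpTo n (λ j → pow z j * hN (k ∸ j) zs))
    split : ∀ k → ∑[ j < suc k ] (pow z j * hN (k ∸ j) zs) ≈ H (z ∷ zs) k
    split zero    = trans (+-identityʳ _) (trans (*-identityˡ _) (hN≈H zero zs))
    split (suc k) = +-cong (trans (*-identityˡ _) (hN≈H (suc k) zs)) (begin
      ∑[ j < suc k ] ((z * pow z j) * hN (k ∸ j) zs) ≈⟨ ∑<-cong (suc k) (λ j _ → *-assoc z (pow z j) (hN (k ∸ j) zs)) ⟩
      ∑[ j < suc k ] (z * (pow z j * hN (k ∸ j) zs)) ≈⟨ *-distribˡ-∑< (suc k) z (λ j → pow z j * hN (k ∸ j) zs) ⟨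
      z * ∑[ j < suc k ] (pow z j * hN (k ∸ j) zs)   ≈⟨ *-cong refl (split k) ⟩
      z * H (z ∷ zs) k                              ∎)

  signedE : List Carrier → ℕ → Carrier
  signedE zs j = pow (- 1#) j * E zs j

  signedE-∷ : ∀ z zs j → signedE (z ∷ zs) j ≈ signedE zs j + (- z) * shift (signedE zs) j
  signedE-∷ z zs zero    = sym (trans (+-cong refl (zeroʳ _)) (+-identityʳ _))
  signedE-∷ z zs (suc j) = begin
    (- 1# * s) * (E zs (suc j) + z * E zs j)           ≈⟨ *-cong (-1*x≈-x s) refl ⟩
    (- s) * (E zs (suc j) + z * E zs j)                ≈⟨ expand s _ z _ ⟩
    (- s) * E zs (suc j) + (- z) * (s * E zs j)        ≈⟨ +-cong (*-cong (sym (-1*x≈-x s)) refl) refl ⟩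
    (- 1# * s) * E zs (suc j) + (- z) * (s * E zs j)   ∎
    where
    s : Carrier
    s = pow (- 1#) j
    expand : ∀ s e₁ z e₀ → (- s) * (e₁ + z * e₀) ≈ (- s) * e₁ + (- z) * (s * e₀)
    expand = solve 4 (λ s e₁ z e₀ → ((⊝ s) ⊗ (e₁ ⊕ z ⊗ e₀)) ⊜ ((⊝ s) ⊗ e₁ ⊕ (⊝ z) ⊗ (s ⊗ e₀))) refl

  H-∷ : ∀ z zs n → H (z ∷ zs) n ≈ H zs n + z * shift (H (z ∷ zs)) n
  H-∷ z zs zero    = sym (trans (+-cong refl (zeroʳ _)) (+-identityʳ _))
  H-∷ z zs (suc n) = refl

  signedE⋆H≈0 : ∀ zs k → (signedE zs ⋆ H zs) (suc k) ≈ 0#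
  signedE⋆H≈0 [] k = ∑<-zero (suc (suc k)) vanish
    where
    vanish : ∀ j → j < suc (suc k) → signedE [] j * H [] (suc k ∸ j) ≈ 0#
    vanish zero    _ = zeroʳ _
    vanish (suc j) _ = trans (*-cong (zeroʳ _) refl) (zeroˡ _)
  signedE⋆H≈0 (z ∷ zs) k = begin
    (ε' ⋆ H') (suc k)                                              ≈⟨ ⋆-congʳ (signedE-∷ z zs) H' (suc k) ⟩
    ((λ j → ε j + (- z) * shift ε j) ⋆ H') (suc k)                 ≈⟨ ⋆-distribʳ-+ ε (λ j → (- z) * shift ε j) H' (suc k) ⟩
    (ε ⋆ H') (suc k) + ((λ j → (- z) * shift ε j) ⋆ H') (suc k)   ≈⟨ +-cong refl (trans (⋆-*ˡ (- z) (shift ε) H' (suc k)) (*-cong refl (shift-⋆ ε H' k))) ⟩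
    (ε ⋆ H') (suc k) + (- z) * (ε ⋆ H') k                          ≈⟨ +-cong (⋆-congˡ ε (H-∷ z zs) (suc k)) refl ⟩
    (ε ⋆ (λ n → H zs n + z * shift H' n)) (suc k) + (- z) * (ε ⋆ H') k
                                                                   ≈⟨ +-cong (⋆-distribˡ-+ ε (H zs) (λ n → z * shift H' n) (suc k)) refl ⟩
    ((ε ⋆ H zs) (suc k) + (ε ⋆ (λ n → z * shift H' n)) (suc k)) + (- z) * (ε ⋆ H') k
                                                                   ≈⟨ +-cong (+-cong (signedE⋆H≈0 zs k) (trans (⋆-*ʳ z ε (shift H') (suc k)) (*-cong refl (⋆-shift ε H' k)))) refl ⟩
    (0# + z * (ε ⋆ H') k) + (- z) * (ε ⋆ H') k                    ≈⟨ +-cong (+-identityˡ _) (sym (-‿distribˡ-* z _)) ⟩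
    z * (ε ⋆ H') k - z * (ε ⋆ H') k                               ≈⟨ -‿inverseʳ _ ⟩
    0#                                                             ∎
    where
    ε ε' H' : ℕ → Carrier
    ε = signedE zs
    ε' = signedE (z ∷ zs)
    H' = H (z ∷ zs)

  E-gap⇒H≉0 : IsIntegralDomain → ¬ 1# ≈ 0# → ∀ n zs →
              (∀ j → j < n → E zs (suc j) ≈ 0#) → ¬ E zs (suc n) ≈ 0# → ¬ H zs (suc n) ≈ 0#
  E-gap⇒H≉0 isID 1≉0 n zs gap Eₙ₊₁≉0 Hₙ₊₁≈0 with isID _ _ last≈0
    where
    term : ℕ → Carrier
    term j = signedE zs j * H zs (suc n ∸ j)
    first≈0 : term 0 ≈ 0#
    first≈0 = trans (*-cong refl Hₙ₊₁≈0) (zeroʳ _)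
    middle≈0 : ∑[ j < n ] term (suc j) ≈ 0#
    middle≈0 = ∑<-zero n (λ j j<n → trans (*-cong (trans (*-cong refl (gap j j<n)) (zeroʳ _)) refl) (zeroˡ _))
    last≈0 : signedE zs (suc n) ≈ 0#
    last≈0 = begin
      signedE zs (suc n)                               ≈⟨ *-identityʳ _ ⟨
      signedE zs (suc n) * 1#                          ≈⟨ *-cong refl (reflexive (≡.cong (H zs) (≡.sym (ℕ.n∸n≡0 n)))) ⟩
      term (suc n)                                     ≈⟨ +-identityˡ _ ⟨
      0# + term (suc n)                                ≈⟨ +-cong middle≈0 refl ⟨
      ∑[ j < n ] term (suc j) + term (suc n)           ≈⟨ +-identityˡ _ ⟨
      0# + (∑[ j < n ] term (suc j) + term (suc n))    ≈⟨ +-cong first≈0 (∑<-last n (term ∘ suc)) ⟨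
      (signedE zs ⋆ H zs) (suc n)                      ≈⟨ signedE⋆H≈0 zs n ⟩
      0#                                               ∎
  ... | inj₁ sⁿ⁺¹≈0 = pow-[-1]≉0 1≉0 (suc n) sⁿ⁺¹≈0
  ... | inj₂ Eₙ₊₁≈0 = Eₙ₊₁≉0 Eₙ₊₁≈0

  IsSymmetric : (List Carrier → ℕ → Carrier) → Set (c ⊔ ℓ)
  IsSymmetric F = ∀ {xs ys} → xs ↭ ys → ∀ k → F xs k ≈ F ys k

  IsHomogeneous : (List Carrier → ℕ → Carrier) → Set (c ⊔ ℓ)
  IsHomogeneous F = ∀ a zs k → F (map (a *_) zs) k ≈ pow a k * F zs k

  module _ {F : List Carrier → ℕ → Carrier}
           (F-cong : ∀ {x y xs ys} → x ≈ y → (∀ k → F xs k ≈ F ys k) → ∀ k → F (x ∷ xs) k ≈ F (y ∷ ys) k)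
           (F-swap : ∀ x y zs k → F (x ∷ y ∷ zs) k ≈ F (y ∷ x ∷ zs) k) where

    ≋⇒≈ : ∀ {xs ys} → xs ≋ ys → ∀ k → F xs k ≈ F ys k
    ≋⇒≈ []            k = refl
    ≋⇒≈ (x≈y ∷ xs≋ys)   = F-cong x≈y (≋⇒≈ xs≋ys)

    swap⇒symmetric : IsSymmetric F
    swap⇒symmetric (Perm.refl xs≋ys)           = ≋⇒≈ xs≋ys
    swap⇒symmetric (Perm.prep x≈y p)           = F-cong x≈y (swap⇒symmetric p)
    swap⇒symmetric (Perm.swap x≈x' y≈y' p) k   =
      trans (F-swap _ _ _ k) (F-cong y≈y' (F-cong x≈x' (swap⇒symmetric p)) k)
    swap⇒symmetric (Perm.trans p q)          k = trans (swap⇒symmetric p k) (swap⇒symmetric q k)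

  H-cong : ∀ {x y xs ys} → x ≈ y → (∀ k → H xs k ≈ H ys k) → ∀ k → H (x ∷ xs) k ≈ H (y ∷ ys) k
  H-cong x≈y Hxs≈Hys zero    = refl
  H-cong x≈y Hxs≈Hys (suc k) = +-cong (Hxs≈Hys (suc k)) (*-cong x≈y (H-cong x≈y Hxs≈Hys k))

  E-cong : ∀ {x y xs ys} → x ≈ y → (∀ k → E xs k ≈ E ys k) → ∀ k → E (x ∷ xs) k ≈ E (y ∷ ys) k
  E-cong x≈y Exs≈Eys zero    = refl
  E-cong x≈y Exs≈Eys (suc k) = +-cong (Exs≈Eys (suc k)) (*-cong x≈y (Exs≈Eys k))

  H-swap : ∀ a b zs k → H (a ∷ b ∷ zs) k ≈ H (b ∷ a ∷ zs) k
  H-swap a b zs zero          = refl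
  H-swap a b zs (suc zero)    =
    solve 3 (λ w a b → ((w ⊕ b) ⊕ a) ⊜ ((w ⊕ a) ⊕ b)) refl (H zs 1) (a * 1#) (b * 1#)
  H-swap a b zs (suc (suc k)) = begin
    (W + b * U) + a * H (a ∷ b ∷ zs) (suc k)        ≈⟨ +-cong refl (*-cong refl (H-swap a b zs (suc k))) ⟩
    (W + b * U) + a * (V + b * H (b ∷ a ∷ zs) k)    ≈⟨ exchange W a b U V _ ⟩
    (W + a * V) + b * (U + a * H (b ∷ a ∷ zs) k)    ≈⟨ +-cong refl (*-cong refl (+-cong refl (*-cong refl (H-swap a b zs k)))) ⟨
    (W + a * V) + b * H (a ∷ b ∷ zs) (suc k)        ≈⟨ +-cong refl (*-cong refl (H-swap a b zs (suc k))) ⟩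
    (W + a * V) + b * H (b ∷ a ∷ zs) (suc k)        ∎
    where
    exchange : ∀ w a b u v y → (w + b * u) + a * (v + b * y) ≈ (w + a * v) + b * (u + a * y)
    exchange = solve 6 (λ w a b u v y → ((w ⊕ b ⊗ u) ⊕ a ⊗ (v ⊕ b ⊗ y)) ⊜ ((w ⊕ a ⊗ v) ⊕ b ⊗ (u ⊕ a ⊗ y))) refl
    W U V : Carrier
    W = H zs (suc (suc k))
    U = H (b ∷ zs) (suc k)
    V = H (a ∷ zs) (suc k)

  E-swap : ∀ a b zs k → E (a ∷ b ∷ zs) k ≈ E (b ∷ a ∷ zs) k
  E-swap a b zs zero          = refl
  E-swap a b zs (suc zero)    =
    solve 3 (λ w a b → ((w ⊕ b) ⊕ a) ⊜ ((w ⊕ a) ⊕ b)) refl (E zs 1) (a * 1#) (b * 1#)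
  E-swap a b zs (suc (suc k)) =
    solve 5 (λ a b w₂ w₁ w₀ → ((w₂ ⊕ b ⊗ w₁) ⊕ a ⊗ (w₁ ⊕ b ⊗ w₀)) ⊜ ((w₂ ⊕ a ⊗ w₁) ⊕ b ⊗ (w₁ ⊕ a ⊗ w₀)))
      refl a b (E zs (suc (suc k))) (E zs (suc k)) (E zs k)

  H-symmetric : IsSymmetric H
  H-symmetric = swap⇒symmetric H-cong H-swap

  E-symmetric : IsSymmetric E
  E-symmetric = swap⇒symmetric E-cong E-swap

  private
    homogeneous-step : ∀ a p x z y → (a * p) * x + (a * z) * (p * y) ≈ (a * p) * (x + z * y)
    homogeneous-step = solve 5 (λ a p x z y → ((a ⊗ p) ⊗ x ⊕ (a ⊗ z) ⊗ (p ⊗ y)) ⊜ ((a ⊗ p) ⊗ (x ⊕ z ⊗ y))) refl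

  H-homogeneous : IsHomogeneous H
  H-homogeneous a []       zero    = sym (*-identityˡ _)
  H-homogeneous a []       (suc k) = sym (zeroʳ _)
  H-homogeneous a (z ∷ zs) zero    = sym (*-identityˡ _)
  H-homogeneous a (z ∷ zs) (suc k) =
    trans (+-cong (H-homogeneous a zs (suc k)) (*-cong refl (H-homogeneous a (z ∷ zs) k)))
          (homogeneous-step a (pow a k) (H zs (suc k)) z (H (z ∷ zs) k))

  E-homogeneous : IsHomogeneous E
  E-homogeneous a []       zero    = sym (*-identityˡ _)
  E-homogeneous a []       (suc k) = sym (zeroʳ _)
  E-homogeneous a (z ∷ zs) zero    = sym (*-identityˡ _)
  E-homogeneous a (z ∷ zs) (suc k) =
    trans (+-cong (E-homogeneous a zs (suc k)) (*-cong refl (E-homogeneous a zs k)))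
          (homogeneous-step a (pow a k) (E zs (suc k)) z (E zs k))

  data DropsZeros : List Carrier → List Carrier → Set (c ⊔ ℓ) where
    []   : DropsZeros [] []
    keep : ∀ x {xs ys} → DropsZeros xs ys → DropsZeros (x ∷ xs) (x ∷ ys)
    drop : ∀ {x xs ys} → x ≈ 0# → DropsZeros xs ys → DropsZeros (x ∷ xs) ys

  DropsZeros-++ : ∀ {xs ys xs' ys'} → DropsZeros xs ys → DropsZeros xs' ys' → DropsZeros (xs ++ xs') (ys ++ ys')
  DropsZeros-++ []              d' = d'
  DropsZeros-++ (keep x d)      d' = keep x (DropsZeros-++ d d')
  DropsZeros-++ (drop x≈0 d)    d' = drop x≈0 (DropsZeros-++ d d')

  E-DropsZeros : ∀ {xs ys} → DropsZeros xs ys → ∀ k → E xs k ≈ E ys k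
  E-DropsZeros []           k       = refl
  E-DropsZeros (keep x d)           = E-cong refl (E-DropsZeros d)
  E-DropsZeros (drop x≈0 d) zero    = refl
  E-DropsZeros (drop x≈0 d) (suc k) =
    trans (+-cong (E-DropsZeros d (suc k)) (trans (*-cong x≈0 refl) (zeroˡ _))) (+-identityʳ _)

  E-above-length : ∀ zs k → length zs < k → E zs k ≈ 0#
  E-above-length []       (suc k) _ = refl
  E-above-length (z ∷ zs) (suc k) (s≤s |zs|<k) =
    trans (+-cong (E-above-length zs (suc k) (ℕ.m<n⇒m<1+n |zs|<k))
                  (trans (*-cong refl (E-above-length zs k |zs|<k)) (zeroʳ z)))
          (+-identityʳ 0#)

  E-length≉0 : IsIntegralDomain → ¬ 1# ≈ 0# → ∀ zs → All (λ z → ¬ z ≈ 0#) zs → ¬ E zs (length zs) ≈ 0#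
  E-length≉0 isID 1≉0 []       []            = 1≉0
  E-length≉0 isID 1≉0 (z ∷ zs) (z≉0 ∷ zs≉0) E≈0
    with isID z (E zs (length zs))
              (trans (sym (trans (+-cong (E-above-length zs (suc (length zs)) ℕ.≤-refl) refl) (+-identityˡ _))) E≈0)
  ... | inj₁ z≈0 = z≉0 z≈0
  ... | inj₂ E≈0 = E-length≉0 isID 1≉0 zs zs≉0 E≈0

  unitVector : ∀ m → Vec Carrier (suc m)
  unitVector m = 1# Vec.∷ Vec.replicate m 0#

  module _ {t : ℕ} .{{_ : NonZero t}} {ω : Carrier} (prim : IsPrimitiveRoot t ω) where

    pow-*t≈1 : ∀ q → pow ω (q ℕ.* t) ≈ 1#
    pow-*t≈1 zero    = refl
    pow-*t≈1 (suc q) = trans (pow-+ ω t (q ℕ.* t)) (trans (*-cong (proj₁ prim) (pow-*t≈1 q)) (*-identityˡ _))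

    pow≈1⇒∣ : ∀ k → pow ω k ≈ 1# → t ∣ k
    pow≈1⇒∣ k ωᵏ≈1 with k % t in k%t≡r
    ... | zero  = m%n≡0⇒n∣m k t k%t≡r
    ... | suc r = ⊥-elim (proj₂ prim (suc r) (s≤s z≤n) (≡.subst (_< t) k%t≡r (m%n<n k t)) ωʳ⁺¹≈1)
      where
      ωʳ⁺¹≈1 : pow ω (suc r) ≈ 1#
      ωʳ⁺¹≈1 = begin
        pow ω (suc r)                          ≈⟨ *-identityʳ _ ⟨
        pow ω (suc r) * 1#                     ≈⟨ *-cong refl (pow-*t≈1 (k / t)) ⟨
        pow ω (suc r) * pow ω (k / t ℕ.* t)   ≈⟨ pow-+ ω (suc r) _ ⟨
        pow ω (suc r ℕ.+ k / t ℕ.* t)         ≡⟨ ≡.cong (λ i → pow ω (i ℕ.+ k / t ℕ.* t)) k%t≡r ⟨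
        pow ω (k % t ℕ.+ k / t ℕ.* t)         ≡⟨ ≡.cong (pow ω) (m≡m%n+[m/n]*n k t) ⟨
        pow ω k                                ≈⟨ ωᵏ≈1 ⟩
        1#                                     ∎

    pow≉0 : ¬ 1# ≈ 0# → ∀ k → ¬ pow ω k ≈ 0#
    pow≉0 1≉0 k ωᵏ≈0 = 1≉0 (begin
      1#                                 ≈⟨ pow-*t≈1 k ⟨
      pow ω (k ℕ.* t)                    ≡⟨ ≡.cong (pow ω) (ℕ.m+[n∸m]≡n (ℕ.m≤m*n k t)) ⟨
      pow ω (k ℕ.+ (k ℕ.* t ∸ k))        ≈⟨ pow-+ ω k _ ⟩
      pow ω k * pow ω (k ℕ.* t ∸ k)      ≈⟨ *-cong ωᵏ≈0 refl ⟩
      0# * pow ω (k ℕ.* t ∸ k)           ≈⟨ zeroˡ _ ⟩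
      0#                                 ∎)

    block : List Carrier → ℕ → List Carrier
    block xs k = map (pow ω k *_) xs

    ω*-blocks : ∀ xs is → map (ω *_) (concatMap (block xs) is) ≋ concatMap (block xs ∘ suc) is
    ω*-blocks xs []       = []
    ω*-blocks xs (i ∷ is) = ≡.subst (_≋ concatMap (block xs ∘ suc) (i ∷ is))
      (≡.sym (List.map-++ (ω *_) (block xs i) (concatMap (block xs) is)))
      (Pointwise.++⁺ (ω*-block xs) (ω*-blocks xs is))
      where
      ω*-block : ∀ xs → map (ω *_) (block xs i) ≋ block xs (suc i)
      ω*-block []       = []
      ω*-block (x ∷ xs) = sym (*-assoc ω (pow ω i) x) ∷ ω*-block xs

    rotate-blocks : ∀ xs n → pow ω n ≈ 1# → map (ω *_) (concatMap (block xs) (upTo n)) ↭ concatMap (block xs) (upTo n)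
    rotate-blocks xs zero    _       = ↭-reflexive ≡.refl
    rotate-blocks xs (suc n) ωⁿ⁺¹≈1 =
      ↭-trans (↭-reflexive-≋ rotated) (↭-trans (++-comm middle (B 0 ++ [])) (↭-reflexive (≡.cong (_++ middle) (List.++-identityʳ (B 0)))))
      where
      B : ℕ → List Carrier
      B = block xs
      middle : List Carrier
      middle = concatMap B (applyUpTo suc n)
      shifted : concatMap (B ∘ suc) (upTo (suc n)) ≡ middle ++ (B (suc n) ++ [])
      shifted = ≡.trans (≡.cong List.concat (≡.trans (List.map-upTo (B ∘ suc) (suc n)) (≡.sym (List.map-applyUpTo suc B (suc n)))))
                (≡.trans (≡.cong (concatMap B) (≡.sym (List.applyUpTo-∷ʳ suc n)))
                (List.concatMap-++ B (applyUpTo suc n) (suc n ∷ [])))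
      Bₙ₊₁≋B₀ : B (suc n) ≋ B 0
      Bₙ₊₁≋B₀ = Pointwise.map⁺ _ _ (Pointwise.refl (*-cong ωⁿ⁺¹≈1 refl))
      rotated : map (ω *_) (concatMap B (upTo (suc n))) ≋ middle ++ (B 0 ++ [])
      rotated = ≋-trans (ω*-blocks xs (upTo (suc n)))
                        (≋-trans (≋-reflexive shifted) (Pointwise.++⁺ (≋-refl {middle}) (Pointwise.++⁺ Bₙ₊₁≋B₀ [])))

    twisted-rotate : ∀ {m} (ys : Vec Carrier m) → map (ω *_) (twisted t ω ys) ↭ twisted t ω ys
    twisted-rotate ys = rotate-blocks (toList ys) t (proj₁ prim)

    twisted-vanishes : IsIntegralDomain → ∀ {F} → IsSymmetric F → IsHomogeneous F →
                       ∀ {m} (ys : Vec Carrier m) k → ¬ t ∣ k → F (twisted t ω ys) k ≈ 0#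
    twisted-vanishes isID {F} F-sym F-hom ys k t∤k with isID (pow ω k - 1#) (F Z k) [ωᵏ-1]F≈0
      where
      Z : List Carrier
      Z = twisted t ω ys
      [ωᵏ-1]F≈0 : (pow ω k - 1#) * F Z k ≈ 0#
      [ωᵏ-1]F≈0 = begin
        (pow ω k - 1#) * F Z k              ≈⟨ distribʳ _ _ _ ⟩
        pow ω k * F Z k + (- 1#) * F Z k    ≈⟨ +-cong (trans (sym (F-hom ω Z k)) (F-sym (twisted-rotate ys) k)) (-1*x≈-x _) ⟩
        F Z k - F Z k                       ≈⟨ -‿inverseʳ _ ⟩
        0#                                  ∎
    ... | inj₁ ωᵏ-1≈0 = ⊥-elim (t∤k (pow≈1⇒∣ k (x∙y⁻¹≈ε⇒x≈y _ _ ωᵏ-1≈0)))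
    ... | inj₂ F≈0    = F≈0

    H-twisted-unitVector≉0 : IsIntegralDomain → ¬ 1# ≈ 0# → ∀ m → ¬ H (twisted t ω (unitVector m)) t ≈ 0#
    H-twisted-unitVector≉0 isID 1≉0 m =
      ≡.subst (λ n → ¬ H Z n ≈ 0#) (ℕ.suc-pred t) (E-gap⇒H≉0 isID 1≉0 (ℕ.pred t) Z gap Eₜ≉0)
      where
      ys : Vec Carrier (suc m)
      ys = unitVector m
      Z : List Carrier
      Z = twisted t ω ys
      roots : List Carrier
      roots = map (λ k → pow ω k * 1#) (upTo t)
      zeros-dropped : ∀ ks → DropsZeros (concatMap (block (toList ys)) ks) (map (λ k → pow ω k * 1#) ks)
      zeros-dropped []       = []
      zeros-dropped (k ∷ ks) = DropsZeros-++ (keep _ (drop-zeros m)) (zeros-dropped ks)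
        where
        drop-zeros : ∀ m → DropsZeros (map (pow ω k *_) (toList (Vec.replicate m 0#))) []
        drop-zeros zero    = []
        drop-zeros (suc m) = drop (zeroʳ _) (drop-zeros m)
      roots≉0 : ∀ ks → All (λ z → ¬ z ≈ 0#) (map (λ k → pow ω k * 1#) ks)
      roots≉0 []       = []
      roots≉0 (k ∷ ks) = (λ ωᵏ≈0 → pow≉0 1≉0 k (trans (sym (*-identityʳ _)) ωᵏ≈0)) ∷ roots≉0 ks
      gap : ∀ j → j < ℕ.pred t → E Z (suc j) ≈ 0#
      gap j j<t-1 = twisted-vanishes isID E-symmetric E-homogeneous ys (suc j)
        (λ t∣j+1 → ℕ.<⇒≱ (≡.subst (suc j <_) (ℕ.suc-pred t) (s≤s j<t-1)) (∣⇒≤ t∣j+1))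
      Eₜ≉0 : ¬ E Z (suc (ℕ.pred t)) ≈ 0#
      Eₜ≉0 Eₜ≈0 = E-length≉0 isID 1≉0 roots (roots≉0 (upTo t))
        (trans (reflexive (≡.cong (E roots) (≡.trans (List.length-map _ (upTo t)) (≡.trans (List.length-upTo t) (≡.sym (ℕ.suc-pred t))))))
               (trans (sym (E-DropsZeros (zeros-dropped (upTo t)) (suc (ℕ.pred t)))) Eₜ≈0))

module Determinant {c ℓ : Level} (R : CommutativeRing c ℓ) where

  open CommutativeRing R hiding (zero)
  open Alg R
  open Powers R using (pow-[-1]≉0)

  Transversal : ∀ {n} → (Fin n → Fin n → Set) → (Fin n → Fin n) → Set
  Transversal P σ = Injective _≡_ _≡_ σ × (∀ i → P i (σ i))

  SupportedOn : ∀ {n} → (Fin n → Fin n → Set) → (Fin n → Fin n → Carrier) → Set ℓ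
  SupportedOn P A = ∀ i j → ¬ P i j → A i j ≈ 0#

  minor : ∀ {n} → (Fin (suc n) → Fin (suc n) → Carrier) → Fin (suc n) → Fin n → Fin n → Carrier
  minor A j a b = A (Fin.suc a) (punchIn j b)

  minorPattern : ∀ {n} → (Fin (suc n) → Fin (suc n) → Set) → Fin (suc n) → Fin n → Fin n → Set
  minorPattern P j a b = P (Fin.suc a) (punchIn j b)

  extend : ∀ {n} → Fin (suc n) → (Fin n → Fin n) → Fin (suc n) → Fin (suc n)
  extend j τ Fin.zero    = j
  extend j τ (Fin.suc a) = punchIn j (τ a)

  extend-transversal : ∀ {n} {P : Fin (suc n) → Fin (suc n) → Set} {j τ} →
                       P Fin.zero j → Transversal (minorPattern P j) τ → Transversal P (extend j τ)
  extend-transversal {j = j} {τ} P₀ⱼ (τ-inj , τ-supp) = injective , λ { Fin.zero → P₀ⱼ ; (Fin.suc a) → τ-supp a }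
    where
    injective : Injective _≡_ _≡_ (extend j τ)
    injective {Fin.zero}  {Fin.zero}  _ = ≡.refl
    injective {Fin.zero}  {Fin.suc b} e = ⊥-elim (Fin.punchInᵢ≢i j (τ b) (≡.sym e))
    injective {Fin.suc a} {Fin.zero}  e = ⊥-elim (Fin.punchInᵢ≢i j (τ a) e)
    injective {Fin.suc a} {Fin.suc b} e = ≡.cong Fin.suc (τ-inj (Fin.punchIn-injective j _ _ e))

  cofactor : ∀ {n} → (Fin (suc n) → Fin (suc n) → Carrier) → Fin (suc n) → Carrier
  cofactor {n} A j = pow (- 1#) (toℕ j) * (A Fin.zero j * det n (minor A j))

  det-expand : ∀ n A → det (suc n) A ≡ sumL (tabulate (cofactor A))
  det-expand n A = ≡.cong sumL (List.map-tabulate id (cofactor A))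

  sumL-tabulate-≈0 : ∀ {n} (f : Fin n → Carrier) → (∀ j → f j ≈ 0#) → sumL (tabulate f) ≈ 0#
  sumL-tabulate-≈0 {zero}  f f≈0 = refl
  sumL-tabulate-≈0 {suc n} f f≈0 = trans (+-cong (f≈0 Fin.zero) (sumL-tabulate-≈0 (f ∘ Fin.suc) (f≈0 ∘ Fin.suc))) (+-identityˡ 0#)

  sumL-tabulate-single : ∀ {n} (f : Fin n → Carrier) j₀ → (∀ j → j ≢ j₀ → f j ≈ 0#) → sumL (tabulate f) ≈ f j₀
  sumL-tabulate-single f Fin.zero      f≈0 =
    trans (+-cong refl (sumL-tabulate-≈0 (f ∘ Fin.suc) (λ j → f≈0 (Fin.suc j) λ ()))) (+-identityʳ _)
  sumL-tabulate-single f (Fin.suc j₀)  f≈0 =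
    trans (+-cong (f≈0 Fin.zero λ ()) (sumL-tabulate-single (f ∘ Fin.suc) j₀ (λ j j≢j₀ → f≈0 (Fin.suc j) (j≢j₀ ∘ Fin.suc-injective))))
          (+-identityˡ _)

  det≈0 : ∀ {n} (A : Fin n → Fin n → Carrier) (P : Fin n → Fin n → Set) → Decidable P →
          SupportedOn P A → (∀ σ → ¬ Transversal P σ) → det n A ≈ 0#
  cofactor≈0 : ∀ {n} (A : Fin (suc n) → Fin (suc n) → Carrier) (P : Fin (suc n) → Fin (suc n) → Set) →
               Decidable P → SupportedOn P A →
               ∀ j → (P Fin.zero j → ∀ τ → ¬ Transversal (minorPattern P j) τ) → cofactor A j ≈ 0#

  det≈0 {zero}  A P P? A-supp none = ⊥-elim (none id ((λ e → e) , λ ()))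
  det≈0 {suc n} A P P? A-supp none = trans (reflexive (det-expand n A)) (sumL-tabulate-≈0 (cofactor A)
    (λ j → cofactor≈0 A P P? A-supp j (λ P₀ⱼ τ τ-tr → none (extend j τ) (extend-transversal {P = P} P₀ⱼ τ-tr))))

  cofactor≈0 {n} A P P? A-supp j minor-none with P? Fin.zero j
  ... | no ¬P₀ⱼ = trans (*-cong refl (trans (*-cong (A-supp _ _ ¬P₀ⱼ) refl) (zeroˡ _))) (zeroʳ _)
  ... | yes P₀ⱼ = trans (*-cong refl (trans (*-cong refl minor≈0) (zeroʳ _))) (zeroʳ _)
    where
    minor≈0 : det n (minor A j) ≈ 0#
    minor≈0 = det≈0 (minor A j) (minorPattern P j) (λ a b → P? (Fin.suc a) (punchIn j b)) (λ a b → A-supp _ _)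
                    (minor-none P₀ⱼ)

  det≉0 : IsIntegralDomain → ¬ 1# ≈ 0# →
          ∀ {n} (A : Fin n → Fin n → Carrier) (P : Fin n → Fin n → Set) → Decidable P → SupportedOn P A →
          ∀ σ → Transversal P σ → (∀ i → ¬ A i (σ i) ≈ 0#) → (∀ τ → Transversal P τ → τ ≗ σ) →
          ¬ det n A ≈ 0#
  det≉0 isID 1≉0 {zero}  A P P? A-supp σ σ-tr σ≉0 unique = 1≉0
  det≉0 isID 1≉0 {suc n} A P P? A-supp σ (σ-inj , σ-supp) σ≉0 unique det≈0' = cofactor₀≉0 (begin
    cofactor A j₀                   ≈⟨ sumL-tabulate-single (cofactor A) j₀ others≈0 ⟨
    sumL (tabulate (cofactor A))    ≡⟨ det-expand n A ⟨
    det (suc n) A                   ≈⟨ det≈0' ⟩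
    0#                              ∎)
    where
    open import Relation.Binary.Reasoning.Setoid setoid
    j₀ : Fin (suc n)
    j₀ = σ Fin.zero
    others≈0 : ∀ j → j ≢ j₀ → cofactor A j ≈ 0#
    others≈0 j j≢j₀ = cofactor≈0 A P P? A-supp j
      (λ P₀ⱼ τ τ-tr → j≢j₀ (unique (extend j τ) (extend-transversal {P = P} P₀ⱼ τ-tr) Fin.zero))
    j₀≢σ₊ : ∀ a → j₀ ≢ σ (Fin.suc a)
    j₀≢σ₊ a e with σ-inj e
    ... | ()
    σ' : Fin n → Fin n
    σ' a = punchOut (j₀≢σ₊ a)
    punchIn-σ' : ∀ a → punchIn j₀ (σ' a) ≡ σ (Fin.suc a)
    punchIn-σ' a = Fin.punchIn-punchOut (j₀≢σ₊ a)
    σ'-transversal : Transversal (minorPattern P j₀) σ'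
    σ'-transversal = (λ {a} {b} e → Fin.suc-injective (σ-inj (Fin.punchOut-injective (j₀≢σ₊ a) (j₀≢σ₊ b) e)))
                   , λ a → ≡.subst (P (Fin.suc a)) (≡.sym (punchIn-σ' a)) (σ-supp (Fin.suc a))
    σ'-unique : ∀ τ → Transversal (minorPattern P j₀) τ → τ ≗ σ'
    σ'-unique τ τ-tr a = Fin.punchIn-injective j₀ _ _
      (≡.trans (unique (extend j₀ τ) (extend-transversal {P = P} (σ-supp Fin.zero) τ-tr) (Fin.suc a)) (≡.sym (punchIn-σ' a)))
    minor≉0 : ¬ det n (minor A j₀) ≈ 0#
    minor≉0 = det≉0 isID 1≉0 (minor A j₀) (minorPattern P j₀) (λ a b → P? (Fin.suc a) (punchIn j₀ b)) (λ a b → A-supp _ _)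
                    σ' σ'-transversal
                    (λ a → ≡.subst (λ j → ¬ A (Fin.suc a) j ≈ 0#) (≡.sym (punchIn-σ' a)) (σ≉0 (Fin.suc a)))
                    σ'-unique
    cofactor₀≉0 : ¬ cofactor A j₀ ≈ 0#
    cofactor₀≉0 c≈0 with isID _ _ c≈0
    ... | inj₁ sʲ≈0 = pow-[-1]≉0 1≉0 (toℕ j₀) sʲ≈0
    ... | inj₂ a*d≈0 with isID _ _ a*d≈0
    ...   | inj₁ a≈0 = σ≉0 Fin.zero a≈0
    ...   | inj₂ d≈0 = minor≉0 d≈0

module TwistedSkewSchur {c ℓ : Level} (R : CommutativeRing c ℓ) where

  open CommutativeRing R hiding (zero)
  open Alg R
  open SymmetricFunctions R
  open Determinant R

  module WithPartition (isID : IsIntegralDomain) (1≉0 : ¬ 1# ≈ 0#) {t : ℕ} .{{_ : NonZero t}} {ω : Carrier} (prim : IsPrimitiveRoot t ω)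
           {N : ℕ} (lam : Vec ℕ N) (part : IsPartition lam) where

    entry : Vec ℕ N → List Carrier → Fin N → Fin N → Carrier
    entry mu zs i j = h (((ℤ.+ lookup lam i) ℤ.- (ℤ.+ lookup mu j)) ℤ.- (ℤ.+ toℕ i) ℤ.+ (ℤ.+ toℕ j)) zs

    entry-≤ : ∀ mu zs {i j} → β mu j ≤ β lam i → entry mu zs i j ≈ H zs (β lam i ∸ β mu j)
    entry-≤ mu zs {i} {j} βμⱼ≤βλᵢ =
      trans (reflexive (≡.cong (λ k → h k zs) (≡.trans (β⊖β lam mu i j) (ℤ.⊖-≥ βμⱼ≤βλᵢ)))) (hN≈H (β lam i ∸ β mu j) zs)

    entry-> : ∀ mu zs {i j} → β lam i < β mu j → entry mu zs i j ≈ 0#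
    entry-> mu zs {i} {j} βλᵢ<βμⱼ =
      reflexive (≡.trans (≡.cong (λ k → h k zs) (≡.trans (β⊖β lam mu i j) (ℤ.⊖-< βλᵢ<βμⱼ))) (h-negative (ℕ.m<n⇒0<n∸m βλᵢ<βμⱼ)))
      where
      h-negative : ∀ {d} → 0 < d → h (ℤ.- (ℤ.+ d)) zs ≡ 0#
      h-negative {suc d} _ = ≡.refl

    reaches? : (γ : Fin N → ℕ) → Decidable (Reaches t (β lam) γ)
    reaches? γ i j = (γ j ≤? β lam i) ×-dec (t ∣? (β lam i ∸ γ j))

    entry-supported : ∀ mu {γ} → (∀ j → β mu j ≡ γ j) → ∀ {m} (ys : Vec Carrier m) →
                      SupportedOn (Reaches t (β lam) γ) (entry mu (twisted t ω ys))
    entry-supported mu {γ} βμ≗γ ys i j ¬reaches with γ j ≤? β lam i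
    ... | no  γⱼ≰βλᵢ = entry-> mu _ (≡.subst (β lam i <_) (≡.sym (βμ≗γ j)) (ℕ.≰⇒> γⱼ≰βλᵢ))
    ... | yes γⱼ≤βλᵢ = trans (entry-≤ mu _ (≡.subst (_≤ β lam i) (≡.sym (βμ≗γ j)) γⱼ≤βλᵢ))
      (trans (reflexive (≡.cong (H (twisted t ω ys)) (≡.cong (β lam i ∸_) (βμ≗γ j))))
             (twisted-vanishes prim isID H-symmetric H-homogeneous ys _ (λ t∣ → ¬reaches (γⱼ≤βλᵢ , t∣))))

    TCore⇒skewSchur≈0 : IsTCore t lam → ∀ mu → IsPartition mu → mu ⊆ₚ lam → mu ≢ lam →
                        ∀ {m} (ys : Vec Carrier m) → skewSchur lam mu (twisted t ω ys) ≈ 0#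
    TCore⇒skewSchur≈0 core mu mu-part mu⊆lam mu≢lam ys =
      det≈0 (entry mu (twisted t ω ys)) (Reaches t (β lam) (β mu)) (reaches? (β mu)) (entry-supported mu (λ _ → ≡.refl) ys)
            λ τ (τ-inj , τ-reaches) → mu≢lam (β-cancel mu lam
              (reaching-transversal⇒≗ (TCore.IsTCore⇒DownClosed part core) (β-strictlyDecreasing mu mu-part)
                                      (β-mono mu lam mu⊆lam) τ-inj τ-reaches))

    module HookWitness (p : Fin N) (t≤bₚ : t ≤ β lam p) (x∉b : ∀ i → β lam i ≢ β lam p ∸ t) where

      open HookRemoval (ℕ.>-nonZero⁻¹ t) (β-strictlyDecreasing lam part) p t≤bₚ x∉b

      μ : Vec ℕ N
      μ = fromβ γ↓

      μ-partition : IsPartition μ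
      μ-partition = fromβ-partition γ↓

      μ⊆lam : μ ⊆ₚ lam
      μ⊆lam i = β-cancel-≤ μ lam i (≡.subst (_≤ β lam i) (≡.sym (β-fromβ γ↓ i)) (γ≤b i))

      μ≢lam : μ ≢ lam
      μ≢lam μ≡lam = x∉b moved (≡.trans (≡.cong (λ v → β v moved) (≡.sym μ≡lam)) (≡.trans (β-fromβ γ↓ moved) γ-moved))

      b-injective : Injective _≡_ _≡_ (β lam)
      b-injective = StrictlyDecreasing⇒injective (β-strictlyDecreasing lam part)

      target-injective : Injective _≡_ _≡_ target
      target-injective {i} {j} eq with i Fin.≟ p | j Fin.≟ p
      ... | yes i≡p | yes j≡p = ≡.trans i≡p (≡.sym j≡p)
      ... | yes i≡p | no  j≢p = ⊥-elim (x∉b j (≡.trans (≡.sym (target-≢ j≢p)) (≡.trans (≡.sym eq) (≡.trans (≡.cong target i≡p) target-p))))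
      ... | no  i≢p | yes j≡p = ⊥-elim (x∉b i (≡.trans (≡.sym (target-≢ i≢p)) (≡.trans eq (≡.trans (≡.cong target j≡p) target-p))))
      ... | no  i≢p | no  j≢p = b-injective (≡.trans (≡.sym (target-≢ i≢p)) (≡.trans eq (target-≢ j≢p)))

      target-gap : ∀ i → target i ≤ β lam i × (β lam i ∸ target i ≡ t ⊎ β lam i ∸ target i ≡ 0)
      target-gap i with i Fin.≟ p
      ... | yes ≡.refl = ≡.subst (λ g → g ≤ β lam p × (β lam p ∸ g ≡ t ⊎ β lam p ∸ g ≡ 0)) (≡.sym target-p)
                           (ℕ.m∸n≤m (β lam p) t , inj₁ (ℕ.m∸[m∸n]≡n t≤bₚ))
      ... | no  i≢p    = ≡.subst (λ g → g ≤ β lam i × (β lam i ∸ g ≡ t ⊎ β lam i ∸ g ≡ 0)) (≡.sym (target-≢ i≢p))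
                           (ℕ.≤-refl , inj₂ (ℕ.n∸n≡0 (β lam i)))

      twistedUnit : ∀ m → List Carrier
      twistedUnit m = twisted t ω (unitVector m)

      βμ∘σ≗target : ∀ i → β μ (σ i) ≡ target i
      βμ∘σ≗target i = ≡.trans (β-fromβ γ↓ (σ i)) (γ∘σ≗target i)

      σ-transversal : Transversal (Reaches t (β lam) γ) σ
      σ-transversal = (λ {i} {j} σᵢ≡σⱼ → target-injective (≡.trans (≡.sym (γ∘σ≗target i)) (≡.trans (≡.cong γ σᵢ≡σⱼ) (γ∘σ≗target j))))
                    , λ i → ≡.subst (λ g → g ≤ β lam i × t ∣ β lam i ∸ g) (≡.sym (γ∘σ≗target i)) (reaches (target-gap i))
        where
        reaches : ∀ {g b} → g ≤ b × (b ∸ g ≡ t ⊎ b ∸ g ≡ 0) → g ≤ b × t ∣ b ∸ g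
        reaches (g≤b , inj₁ b-g≡t) = g≤b , ≡.subst (t ∣_) (≡.sym b-g≡t) ∣-refl
        reaches (g≤b , inj₂ b-g≡0) = g≤b , divides 0 b-g≡0

      σ-entry≉0 : ∀ m i → ¬ entry μ (twistedUnit m) i (σ i) ≈ 0#
      σ-entry≉0 m i entry≈0 with target-gap i
      ... | target≤ , gap = H≉0 gap (begin
        H (twistedUnit m) (β lam i ∸ target i)     ≡⟨ ≡.cong (λ g → H (twistedUnit m) (β lam i ∸ g)) (βμ∘σ≗target i) ⟨
        H (twistedUnit m) (β lam i ∸ β μ (σ i))    ≈⟨ entry-≤ μ (twistedUnit m) (≡.subst (_≤ β lam i) (≡.sym (βμ∘σ≗target i)) target≤) ⟨
        entry μ (twistedUnit m) i (σ i)            ≈⟨ entry≈0 ⟩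
        0#                                         ∎)
        where
        open import Relation.Binary.Reasoning.Setoid setoid
        H≉0 : ∀ {d} → d ≡ t ⊎ d ≡ 0 → ¬ H (twistedUnit m) d ≈ 0#
        H≉0 (inj₁ ≡.refl) = H-twisted-unitVector≉0 prim isID 1≉0 m
        H≉0 (inj₂ ≡.refl) = 1≉0

      σ-unique : ∀ τ → Transversal (Reaches t (β lam) γ) τ → ∀ i → τ i ≡ σ i
      σ-unique τ (τ-inj , τ-reaches) i = γ-injective (≡.trans γτᵢ≡target (≡.sym (γ∘σ≗target i)))
        where
        γ-injective : Injective _≡_ _≡_ γ
        γ-injective = StrictlyDecreasing⇒injective γ↓
        γτᵢ≡target : γ (τ i) ≡ target i
        γτᵢ≡target = reaching-transversal⇒γ∘τ≗target b-injective γ-injective (λ _ → target-≢) target-p (ℕ.m∸n+n≡m t≤bₚ)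
                       (λ i → x∉b i) ρ target∘ρ≗γ τ-inj τ-reaches i

      skewSchur≉0 : ∀ m → ¬ skewSchur lam μ (twistedUnit m) ≈ 0#
      skewSchur≉0 m = det≉0 isID 1≉0 (entry μ (twistedUnit m)) (Reaches t (β lam) γ) (reaches? γ) (entry-supported μ (β-fromβ γ↓) _)
                            σ σ-transversal (σ-entry≉0 m) σ-unique

    HasNonvanishingSkew : Set ℓ
    HasNonvanishingSkew = ∃[ mu ] IsPartition mu × mu ⊆ₚ lam × mu ≢ lam ×
                                  (∀ m → ¬ skewSchur lam mu (twisted t ω (unitVector m)) ≈ 0#)

    hook⇒nonvanishingSkew : ∃[ p ] t ≤ β lam p × (∀ i → β lam i ≢ β lam p ∸ t) → HasNonvanishingSkew
    hook⇒nonvanishingSkew (p , t≤bₚ , x∉b) = μ , μ-partition , μ⊆lam , μ≢lam , skewSchur≉0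
      where open HookWitness p t≤bₚ x∉b

    vanishing⇒TCore : ∀ m → (∀ mu → IsPartition mu → mu ⊆ₚ lam → mu ≢ lam →
                              (ys : Vec Carrier (suc m)) → skewSchur lam mu (twisted t ω ys) ≈ 0#) → IsTCore t lam
    vanishing⇒TCore m vanishing = decidable-stable (List.≡-dec ℕ._≟_ (tCore t lam) (Vec.toList lam)) λ ¬core →
      let (mu , mu-part , mu⊆lam , mu≢lam , skewSchur≉0) =
            hook⇒nonvanishingSkew (¬DownClosed⇒hook (¬core ∘ TCore.DownClosed⇒IsTCore part))
      in skewSchur≉0 m (vanishing mu mu-part mu⊆lam mu≢lam (unitVector m))
  CharZero⇒1≉0 : CharZero → ¬ 1# ≈ 0#
  CharZero⇒1≉0 charZero 1≈0 = charZero 1 ℕ.≤-refl (trans (+-cong 1≈0 refl) (+-identityʳ 0#))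

open import Data.Nat using (_*_)

lemma5p2 : ∀ {c ℓ} (R : CommutativeRing c ℓ)
    → Alg.IsIntegralDomain R → Alg.CharZero R
    → (t : ℕ) .{{_ : NonZero t}} → 2 ≤ t
    → (ω : CommutativeRing.Carrier R) → Alg.IsPrimitiveRoot R t ω
    → (m : ℕ) → 1 ≤ m
    → (lam : Vec ℕ (t * m)) → IsPartition lam
    → (((mu : Vec ℕ (t * m)) → IsPartition mu → mu ⊆ₚ lam → mu ≢ lam
          → (ys : Vec (CommutativeRing.Carrier R) m)
          → CommutativeRing._≈_ R (Alg.skewSchur R lam mu (Alg.twisted R t ω ys)) (CommutativeRing.0# R))
       → IsTCore t lam)
      × (IsTCore t lam
       → (mu : Vec ℕ (t * m)) → IsPartition mu → mu ⊆ₚ lam → mu ≢ lam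
          → (ys : Vec (CommutativeRing.Carrier R) m)
          → CommutativeRing._≈_ R (Alg.skewSchur R lam mu (Alg.twisted R t ω ys)) (CommutativeRing.0# R))
lemma5p2 R isID charZero t _ ω prim zero    ()  lam part
lemma5p2 R isID charZero t _ ω prim (suc m) _   lam part = vanishing⇒TCore m , λ core mu mu-part mu⊆lam mu≢lam → TCore⇒skewSchur≈0 core mu mu-part mu⊆lam mu≢lam
  where open TwistedSkewSchur R
        open WithPartition isID (CharZero⇒1≉0 charZero) prim lam part
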